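{- Let $d=(d_1,\ldots,d_n)$ be a non-increasing sequence of positive integers such that $\sum_{i=1}^n d_i=2n-2c$ for some positive integer $c$ and $n_1(d)\leq n_{\geq 2}(d)$. Then there is a forest $F$ with $c$ components and degree sequence $d$ such that (i) there are exactly $n_1(d)$ support vertices in $F$, each of which is adjacent to exactly one vertex of degree $1$; (ii) the vertices in $V_{\geq 2}(F)$ that are not support vertices are all of degree $2$, and induce a path $P$ of order $n-2n_1(d)$; (iii) $\gamma(F)=\left\lceil\frac{n+n_1(d)-2}{3}\right\rceil$ and $\alpha(F)=\left\lceil\frac{n}{2}\right\rceil$.
   Context: Graphs are finite, simple and undirected. For an integer $i\ge0$, $n_i(d)$ and $n_{\geq i}(d)$ denote the number of entries of $d$ equal to $i$ and at least $i$, respectively. For a graph $G$, $V_{\geq 2}(G)$ is the set of vertices of degree at least $2$. A support vertex is a vertex of degree at least $2$ that has a neighbor of degree $1$. $\gamma(F)$ is the domination number (minimum size of a set $D$ such that every vertex outside $D$ has a neighbor in $D$) and $\alpha(F)$ is the independence number (maximum size of a set of pairwise non-adjacent vertices). -}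

module Defs where

open import Data.Nat using (ℕ; zero; suc; _+_; _*_; _∸_; _≤_; _/_; _≤ᵇ_; _≡ᵇ_)
open import Data.Bool using (Bool; true; false; _∧_; not)
open import Data.Fin using (Fin; toℕ; inject₁; fromℕ) renaming (zero to fzero; suc to fsuc)
open import Data.Fin.Subset using (Subset; _∈_; ∣_∣)
open import Data.Vec using (Vec; tabulate; sum)
open import Data.Product using (Σ; ∃; _×_; _,_)
open import Data.Sum using (_⊎_)
open import Relation.Binary.PropositionalEquality using (_≡_)
open import Relation.Nullary using (¬_)
open import Function.Definitions using (Injective; Surjective)
open import Function.Bundles using (_⇔_)

record Graph (n : ℕ) : Set where
  field
    adj    : Fin n → Fin n → Bool
    sym    : ∀ u v → adj u v ≡ adj v u
    irrefl : ∀ v → adj v v ≡ false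
open Graph public

count : {n : ℕ} → (Fin n → Bool) → ℕ
count P = ∣ tabulate P ∣

deg : {n : ℕ} → Graph n → Fin n → ℕ
deg G v = count (adj G v)

seqSum : {n : ℕ} → (Fin n → ℕ) → ℕ
seqSum d = sum (tabulate d)

NonIncreasing : {n : ℕ} → (Fin n → ℕ) → Set
NonIncreasing d = ∀ i j → toℕ i ≤ toℕ j → d j ≤ d i

nEq : {n : ℕ} → ℕ → (Fin n → ℕ) → ℕ
nEq i d = count (λ k → d k ≡ᵇ i)

nGe : {n : ℕ} → ℕ → (Fin n → ℕ) → ℕ
nGe i d = count (λ k → i ≤ᵇ d k)

data Reach {n : ℕ} (G : Graph n) : Fin n → Fin n → Set where
  here : ∀ {v} → Reach G v v
  step : ∀ {u w v} → adj G u w ≡ true → Reach G w v → Reach G u v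

-- G has exactly c connected components: the components are in bijection
-- with Fin c via a surjective labelling comp that identifies exactly
-- mutually reachable vertices.
HasComponents : {n : ℕ} → Graph n → ℕ → Set
HasComponents {n} G c =
  Σ (Fin n → Fin c) λ comp →
    Surjective _≡_ _≡_ comp × (∀ u v → (comp u ≡ comp v) ⇔ Reach G u v)

Cycle : {n : ℕ} → Graph n → Set
Cycle {n} G =
  Σ ℕ λ k → Σ (Fin (suc (suc (suc k))) → Fin n) λ p →
    Injective _≡_ _≡_ p
    × (∀ (i : Fin (suc (suc k))) → adj G (p (inject₁ i)) (p (fsuc i)) ≡ true)
    × adj G (p (fromℕ (suc (suc k)))) (p fzero) ≡ true

Forest : {n : ℕ} → Graph n → Set
Forest G = ¬ Cycle G

-- G has degree sequence d (vertex v has degree d v; any graph with degree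
-- sequence d is isomorphic to one labelled this way)
HasDegrees : {n : ℕ} → Graph n → (Fin n → ℕ) → Set
HasDegrees G d = ∀ v → deg G v ≡ d v

leafNbrs : {n : ℕ} → Graph n → Fin n → ℕ
leafNbrs G v = count (λ u → adj G v u ∧ (deg G u ≡ᵇ 1))

isSupport : {n : ℕ} → Graph n → Fin n → Bool
isSupport G v = (2 ≤ᵇ deg G v) ∧ (1 ≤ᵇ leafNbrs G v)

isInnerNonSupport : {n : ℕ} → Graph n → Fin n → Bool
isInnerNonSupport G v = (2 ≤ᵇ deg G v) ∧ not (isSupport G v)

InducesPath : {n : ℕ} → Graph n → (Fin n → Bool) → ℕ → Set
InducesPath {n} G S m =
  Σ (Fin m → Fin n) λ p →
    Injective _≡_ _≡_ p
    × (∀ v → (S v ≡ true) ⇔ (∃ λ i → p i ≡ v))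
    × (∀ i j → (adj G (p i) (p j) ≡ true)
               ⇔ (toℕ i ≡ suc (toℕ j) ⊎ toℕ j ≡ suc (toℕ i)))

Dominating : {n : ℕ} → Graph n → Subset n → Set
Dominating G D = ∀ v → ¬ (v ∈ D) → ∃ λ u → u ∈ D × adj G v u ≡ true

Independent : {n : ℕ} → Graph n → Subset n → Set
Independent G D = ∀ u v → u ∈ D → v ∈ D → adj G u v ≡ false

DominationNumber : {n : ℕ} → Graph n → ℕ → Set
DominationNumber G k =
  (∃ λ D → Dominating G D × ∣ D ∣ ≡ k) × (∀ D → Dominating G D → k ≤ ∣ D ∣)

IndependenceNumber : {n : ℕ} → Graph n → ℕ → Set
IndependenceNumber G k =
  (∃ λ D → Independent G D × ∣ D ∣ ≡ k) × (∀ D → Independent G D → ∣ D ∣ ≤ k)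

ceil3 : ℕ → ℕ
ceil3 a = (a + 2) / 3

ceil2 : ℕ → ℕ
ceil2 a = (a + 1) / 2

module Submission where

-- Let b = n_{≥3}(d), k = n_{≥2}(d) − n_1(d) and l = n_1(d).  The forest F is a
-- caterpillar-like tree together with c − 1 copies of P₄.  The tree's spine runs
-- through the b vertices of degree ≥ 3, then k vertices of degree 2 (the path P),
-- closed off by a head and a tail; each vertex of degree d_x ≥ 3 carries d_x − 3
-- pendant vertices; every big vertex, the head, the tail, the pendants and the
-- inner vertices of the P₄'s are supports with exactly one leaf each.  The
-- hypothesis Σ d = 2n − 2c says exactly that there are n_1(d) supports, so F has
-- degree sequence d and n = k + 2l.

open import Defs hiding (sym)
open import Data.Nat using (ℕ; zero; suc; _+_; _*_; _∸_; _≤_; _<_; z≤n; s≤s; z<s; s<s; _≤ᵇ_; _≡ᵇ_; _<ᵇ_; pred; _<?_; _≤?_; _≟_; _/_)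
open import Data.Nat.Properties
open import Data.Nat.DivMod using (m/n≡1+[m∸n]/n)
open import Data.Nat.Tactic.RingSolver using (solve-∀)
open import Data.Bool using (Bool; true; false; _∧_; _∨_; if_then_else_; T)
open import Data.Bool.Properties using (∧-identityʳ; ∧-zeroʳ; ∨-identityʳ; ¬-not)
import Data.Bool.Properties as Bool
open import Data.Fin using (Fin; toℕ; fromℕ<; fromℕ; inject₁) renaming (zero to fzero; suc to fsuc)
open import Data.Fin.Properties using (toℕ-fromℕ<; toℕ-injective; toℕ-inject₁; toℕ-fromℕ; toℕ<n)
open import Data.Fin.Subset using (Subset; _∈_; ∣_∣)
open import Data.Vec using (Vec; []; _∷_; tabulate; here; there)
open import Data.Vec.Properties using (lookup∘tabulate; []=⇒lookup; lookup⇒[]=; tabulate-cong)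
open import Data.List using (List; []; _∷_; _++_)
open import Data.List.Properties using (∷-injectiveˡ)
open import Data.Product using (Σ; ∃; _×_; _,_; proj₁; proj₂)
open import Data.Sum using (_⊎_; inj₁; inj₂)
open import Data.Empty using (⊥; ⊥-elim)
open import Data.Unit using (⊤; tt)
open import Relation.Binary.PropositionalEquality
open import Relation.Nullary using (yes; no; does)
open import Function.Bundles using (mk⇔)

b2n : Bool → ℕ
b2n true = 1
b2n false = 0

T⇒≡true : ∀ {b} → T b → b ≡ true
T⇒≡true {true} _ = refl

≡true⇒T : ∀ {b} → b ≡ true → T b
≡true⇒T refl = tt

true≢false : true ≢ false
true≢false ()

≡ᵇ-true : ∀ x y → (x ≡ᵇ y) ≡ true → x ≡ y
≡ᵇ-true x y e = ≡ᵇ⇒≡ x y (≡true⇒T e)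

≡ᵇ-refl : ∀ x → (x ≡ᵇ x) ≡ true
≡ᵇ-refl x = T⇒≡true (≡⇒≡ᵇ x x refl)

≡ᵇ-false : ∀ x y → x ≢ y → (x ≡ᵇ y) ≡ false
≡ᵇ-false x y x≢y = ¬-not (λ e → x≢y (≡ᵇ-true x y e))

<ᵇ-true : ∀ x y → x < y → (x <ᵇ y) ≡ true
<ᵇ-true x y x<y = T⇒≡true (<⇒<ᵇ x<y)

<ᵇ-T : ∀ x y → (x <ᵇ y) ≡ true → x < y
<ᵇ-T x y e = <ᵇ⇒< x y (≡true⇒T e)

<ᵇ-false : ∀ x y → y ≤ x → (x <ᵇ y) ≡ false
<ᵇ-false x y y≤x = ¬-not (λ e → <⇒≱ (<ᵇ-T x y e) y≤x)

<ᵇ-F : ∀ x y → (x <ᵇ y) ≡ false → y ≤ x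
<ᵇ-F x y e = ≮⇒≥ (λ x<y → true≢false (trans (sym (<ᵇ-true x y x<y)) e))

≤ᵇ-true : ∀ x y → x ≤ y → (x ≤ᵇ y) ≡ true
≤ᵇ-true x y x≤y = T⇒≡true (≤⇒≤ᵇ x≤y)

≤ᵇ-T : ∀ x y → (x ≤ᵇ y) ≡ true → x ≤ y
≤ᵇ-T x y e = ≤ᵇ⇒≤ x y (≡true⇒T e)

≤ᵇ-false : ∀ x y → y < x → (x ≤ᵇ y) ≡ false
≤ᵇ-false x y y<x = ¬-not (λ e → <⇒≱ y<x (≤ᵇ-T x y e))

≤ᵇ-F : ∀ x y → (x ≤ᵇ y) ≡ false → y < x
≤ᵇ-F x y e = ≰⇒> (λ x≤y → true≢false (trans (sym (≤ᵇ-true x y x≤y)) e))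

if-t : ∀ {A : Set} {b} (x y : A) → b ≡ true → (if b then x else y) ≡ x
if-t x y refl = refl

if-f : ∀ {A : Set} {b} (x y : A) → b ≡ false → (if b then x else y) ≡ y
if-f x y refl = refl

∨-T : ∀ a b → (a ∨ b) ≡ true → a ≡ true ⊎ b ≡ true
∨-T true b _ = inj₁ refl
∨-T false b e = inj₂ e

∨-l : ∀ a b → a ≡ true → (a ∨ b) ≡ true
∨-l a b refl = refl

∨-r : ∀ a b → b ≡ true → (a ∨ b) ≡ true
∨-r true b _ = refl
∨-r false b e = e

∧-T : ∀ a b → (a ∧ b) ≡ true → a ≡ true × b ≡ true
∧-T true true _ = refl , refl

-- Counting below a bound:  cnt P n = #{x < n ∣ P x}.  All combinatorics of the
-- construction is done on ℕ-indexed vertices; the results are transported to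
-- Defs.count over Fin n at the end.

cnt : (ℕ → Bool) → ℕ → ℕ
cnt P zero = 0
cnt P (suc n) = b2n (P 0) + cnt (λ x → P (suc x)) n

cnt-ext : ∀ n {P Q : ℕ → Bool} → (∀ x → x < n → P x ≡ Q x) → cnt P n ≡ cnt Q n
cnt-ext zero h = refl
cnt-ext (suc n) h = cong₂ _+_ (cong b2n (h 0 z<s)) (cnt-ext n (λ x p → h (suc x) (s<s p)))

cnt-split : ∀ a c P → cnt P (a + c) ≡ cnt P a + cnt (λ x → P (a + x)) c
cnt-split zero c P = refl
cnt-split (suc a) c P =
  trans (cong (b2n (P 0) +_) (cnt-split a c (λ x → P (suc x)))) (sym (+-assoc (b2n (P 0)) _ _))

cnt-false : ∀ n P → (∀ x → x < n → P x ≡ false) → cnt P n ≡ 0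
cnt-false zero P h = refl
cnt-false (suc n) P h rewrite h 0 z<s = cnt-false n (λ x → P (suc x)) (λ x p → h (suc x) (s<s p))

cnt-true : ∀ n P → (∀ x → x < n → P x ≡ true) → cnt P n ≡ n
cnt-true zero P h = refl
cnt-true (suc n) P h rewrite h 0 z<s = cong suc (cnt-true n (λ x → P (suc x)) (λ x p → h (suc x) (s<s p)))

b2n≤1 : ∀ b → b2n b ≤ 1
b2n≤1 true = ≤-refl
b2n≤1 false = z≤n

cnt-≤ : ∀ n P → cnt P n ≤ n
cnt-≤ zero P = z≤n
cnt-≤ (suc n) P = +-mono-≤ (b2n≤1 (P 0)) (cnt-≤ n (λ x → P (suc x)))

+-interchange : ∀ a b c d → (a + b) + (c + d) ≡ (a + c) + (b + d)
+-interchange = solve-∀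

cnt-or : ∀ n P Q → (∀ x → x < n → P x ≡ true → Q x ≡ false)
       → cnt (λ x → P x ∨ Q x) n ≡ cnt P n + cnt Q n
cnt-or zero P Q h = refl
cnt-or (suc n) P Q h =
  trans (cong₂ _+_ (head (P 0) (Q 0) (h 0 z<s)) (cnt-or n _ _ (λ x p → h (suc x) (s<s p))))
        (+-interchange (b2n (P 0)) (b2n (Q 0)) _ _)
  where
  head : ∀ p q → (p ≡ true → q ≡ false) → b2n (p ∨ q) ≡ b2n p + b2n q
  head false q _ = refl
  head true q f rewrite f refl = refl

cnt-or-≤ : ∀ n P Q → cnt (λ x → P x ∨ Q x) n ≤ cnt P n + cnt Q n
cnt-or-≤ zero P Q = z≤n
cnt-or-≤ (suc n) P Q =
  ≤-trans (+-mono-≤ (head (P 0) (Q 0)) (cnt-or-≤ n _ _))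
          (≤-reflexive (+-interchange (b2n (P 0)) (b2n (Q 0)) _ _))
  where
  head : ∀ p q → b2n (p ∨ q) ≤ b2n p + b2n q
  head false q = ≤-refl
  head true false = ≤-refl
  head true true = s≤s z≤n

cnt-single : ∀ n v → v < n → cnt (λ x → x ≡ᵇ v) n ≡ 1
cnt-single (suc n) zero _ = cong suc (cnt-false n _ (λ x _ → refl))
cnt-single (suc n) (suc v) (s≤s p) = cnt-single n v p

cnt-single-≤ : ∀ n v → cnt (λ x → x ≡ᵇ v) n ≤ 1
cnt-single-≤ zero v = z≤n
cnt-single-≤ (suc n) zero = ≤-reflexive (cong suc (cnt-false n _ (λ x _ → refl)))
cnt-single-≤ (suc n) (suc v) = cnt-single-≤ n v

anyN : (ℕ → Bool) → ℕ → Bool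
anyN Q zero = false
anyN Q (suc n) = Q 0 ∨ anyN (λ x → Q (suc x)) n

anyN-wit : ∀ n Q → anyN Q n ≡ true → ∃ λ x → x < n × Q x ≡ true
anyN-wit (suc n) Q e with ∨-T (Q 0) _ e
... | inj₁ q = 0 , z<s , q
... | inj₂ r with anyN-wit n (λ x → Q (suc x)) r
...   | x , p , q = suc x , s<s p , q

anyN-intro : ∀ n Q x → x < n → Q x ≡ true → anyN Q n ≡ true
anyN-intro (suc n) Q zero p q rewrite q = refl
anyN-intro (suc n) Q (suc x) (s≤s p) q = ∨-r (Q 0) _ (anyN-intro n (λ y → Q (suc y)) x p q)

labelsHit : (ℕ → Bool) → (ℕ → ℕ) → ℕ → ℕ → ℕ
labelsHit P g n B = cnt (λ β → anyN (λ x → P x ∧ (β ≡ᵇ g x)) n) B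

labelsHit-≤ : ∀ n P g B → labelsHit P g n B ≤ cnt P n
labelsHit-≤ zero P g B = ≤-reflexive (cnt-false B _ (λ _ _ → refl))
labelsHit-≤ (suc n) P g B =
  ≤-trans (cnt-or-≤ B _ _)
          (+-mono-≤ (head (P 0) refl) (labelsHit-≤ n (λ x → P (suc x)) (λ x → g (suc x)) B))
  where
  head : ∀ p → P 0 ≡ p → cnt (λ β → P 0 ∧ (β ≡ᵇ g 0)) B ≤ b2n p
  head false e = ≤-reflexive (cnt-false B _ (λ β _ → cong (_∧ (β ≡ᵇ g 0)) e))
  head true e = ≤-trans (≤-reflexive (cnt-ext B (λ β _ → cong (_∧ (β ≡ᵇ g 0)) e))) (cnt-single-≤ B (g 0))

LabelsInjective : (ℕ → Bool) → (ℕ → ℕ) → ℕ → ℕ → Set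
LabelsInjective P g n B =
  (∀ x → x < n → P x ≡ true → g x < B)
  × (∀ x y → x < n → y < n → P x ≡ true → P y ≡ true → g x ≡ g y → x ≡ y)

labelsHit-≥ : ∀ n P g B → LabelsInjective P g n B → cnt P n ≤ labelsHit P g n B
labelsHit-≥ zero P g B _ = z≤n
labelsHit-≥ (suc n) P g B (bounded , injective) = head (P 0) refl
  where
  rest : ℕ → Bool
  rest β = anyN (λ x → P (suc x) ∧ (β ≡ᵇ g (suc x))) n
  IH : cnt (λ x → P (suc x)) n ≤ cnt rest B
  IH = labelsHit-≥ n (λ x → P (suc x)) (λ x → g (suc x)) B
         ( (λ x p q → bounded (suc x) (s<s p) q)
         , (λ x y p q u v w → suc-injective (injective (suc x) (suc y) (s<s p) (s<s q) u v w)))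
  fresh : ∀ β → β < B → (β ≡ᵇ g 0) ≡ true → P 0 ≡ true → rest β ≡ false
  fresh β _ q p0 = ¬-not λ e → case₁ (anyN-wit n _ e)
    where
    case₁ : (∃ λ x → x < n × (P (suc x) ∧ (β ≡ᵇ g (suc x))) ≡ true) → ⊥
    case₁ (x , x<n , r) with ∧-T (P (suc x)) _ r
    ... | px , gx with injective (suc x) 0 (s<s x<n) z<s px p0
                         (trans (sym (≡ᵇ-true β _ gx)) (≡ᵇ-true β _ q))
    ...   | ()
  head : ∀ p → P 0 ≡ p → b2n (P 0) + cnt (λ x → P (suc x)) n
                          ≤ cnt (λ β → (P 0 ∧ (β ≡ᵇ g 0)) ∨ rest β) B
  head false e rewrite e = IH
  head true e rewrite e =
    ≤-trans (s≤s IH)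
      (≤-reflexive (sym (trans (cnt-or B _ _ (λ β β<B q → fresh β β<B q e))
                               (cong (_+ cnt rest B) (cnt-single B (g 0) (bounded 0 z<s e))))))

labels-onto⇒≤ : ∀ n P g B → (∀ β → β < B → ∃ λ x → x < n × P x ≡ true × g x ≡ β) → B ≤ cnt P n
labels-onto⇒≤ n P g B onto = ≤-trans (≤-reflexive (sym (cnt-true B _ hit))) (labelsHit-≤ n P g B)
  where
  hit : ∀ β → β < B → anyN (λ x → P x ∧ (β ≡ᵇ g x)) n ≡ true
  hit β p with onto β p
  ... | x , x<n , px , refl = anyN-intro n _ x x<n (trans (cong (_∧ (g x ≡ᵇ g x)) px) (≡ᵇ-refl (g x)))

labels-injective⇒≤ : ∀ n P g B → LabelsInjective P g n B → cnt P n ≤ B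
labels-injective⇒≤ n P g B inj = ≤-trans (labelsHit-≥ n P g B inj) (cnt-≤ B _)

-- d as a function on ℕ (arbitrary beyond n)
dN : ∀ {n} → (Fin n → ℕ) → ℕ → ℕ
dN {zero} d x = 0
dN {suc n} d zero = d fzero
dN {suc n} d (suc x) = dN (λ i → d (fsuc i)) x

dN-toℕ : ∀ {n} (d : Fin n → ℕ) (i : Fin n) → dN d (toℕ i) ≡ d i
dN-toℕ {suc n} d fzero = refl
dN-toℕ {suc n} d (fsuc i) = dN-toℕ (λ j → d (fsuc j)) i

count-step : ∀ (b : Bool) k → (if does (b Bool.≟ true) then suc else (λ z → z)) k ≡ b2n b + k
count-step true k = refl
count-step false k = refl

count-cnt : ∀ n (P : ℕ → Bool) → count {n} (λ u → P (toℕ u)) ≡ cnt P n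
count-cnt zero P = refl
count-cnt (suc n) P = trans (count-step (P 0) _) (cong (b2n (P 0) +_) (count-cnt n (λ x → P (suc x))))

count-cnt∘ : ∀ {n} (d : Fin n → ℕ) (P : ℕ → Bool) → count {n} (λ u → P (d u)) ≡ cnt (λ x → P (dN d x)) n
count-cnt∘ {zero} d P = refl
count-cnt∘ {suc n} d P =
  trans (count-step (P (d fzero)) _) (cong (b2n (P (d fzero)) +_) (count-cnt∘ (λ i → d (fsuc i)) P))

count-ext : ∀ {n} (f g : Fin n → Bool) → (∀ u → f u ≡ g u) → count f ≡ count g
count-ext f g f≗g = cong ∣_∣ (tabulate-cong f≗g)

lk : ∀ {n} → Vec Bool n → ℕ → Bool
lk [] x = false
lk (b ∷ v) zero = b
lk (b ∷ v) (suc x) = lk v x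

card-cnt : ∀ {n} (D : Subset n) → ∣ D ∣ ≡ cnt (lk D) n
card-cnt [] = refl
card-cnt (b ∷ D) = trans (count-step b _) (cong (b2n b +_) (card-cnt D))

mem→lk : ∀ {n} (D : Subset n) (x : Fin n) → x ∈ D → lk D (toℕ x) ≡ true
mem→lk (_ ∷ D) fzero here = refl
mem→lk (_ ∷ D) (fsuc x) (there p) = mem→lk D x p

lk→mem : ∀ {n} (D : Subset n) (x : Fin n) → lk D (toℕ x) ≡ true → x ∈ D
lk→mem (.true ∷ D) fzero refl = here
lk→mem (_ ∷ D) (fsuc x) e = there (lk→mem D x e)

tab-mem : ∀ {n} (f : Fin n → Bool) (v : Fin n) → v ∈ tabulate f → f v ≡ true
tab-mem f v h = trans (sym (lookup∘tabulate f v)) ([]=⇒lookup h)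

mem-tab : ∀ {n} (f : Fin n → Bool) (v : Fin n) → f v ≡ true → v ∈ tabulate f
mem-tab f v e = lookup⇒[]= v (tabulate f) (trans (lookup∘tabulate f v) e)

sumN : (ℕ → ℕ) → ℕ → ℕ
sumN f zero = 0
sumN f (suc n) = f 0 + sumN (λ x → f (suc x)) n

seqSum-sumN : ∀ {n} (d : Fin n → ℕ) → seqSum d ≡ sumN (dN d) n
seqSum-sumN {zero} d = refl
seqSum-sumN {suc n} d = cong (d fzero +_) (seqSum-sumN (λ i → d (fsuc i)))

sumN-split : ∀ a c f → sumN f (a + c) ≡ sumN f a + sumN (λ x → f (a + x)) c
sumN-split zero c f = refl
sumN-split (suc a) c f = trans (cong (f 0 +_) (sumN-split a c (λ x → f (suc x)))) (sym (+-assoc (f 0) _ _))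

sumN-const : ∀ c f v → (∀ x → x < c → f x ≡ v) → sumN f c ≡ c * v
sumN-const zero f v h = refl
sumN-const (suc c) f v h = cong₂ _+_ (h 0 z<s) (sumN-const c (λ x → f (suc x)) v (λ x p → h (suc x) (s<s p)))

sumN-snoc : ∀ B f → sumN f (suc B) ≡ sumN f B + f B
sumN-snoc zero f = +-identityʳ (f 0)
sumN-snoc (suc B) f = trans (cong (f 0 +_) (sumN-snoc B (λ x → f (suc x)))) (sym (+-assoc (f 0) _ _))

-- Predicates closed downwards below n ("prefix" predicates): P holds exactly
-- on the first  cnt P n  numbers.  For a non-increasing sequence the tests
-- d x ≥ i are of this kind.

DownClosed : ℕ → (ℕ → Bool) → Set
DownClosed n P = ∀ x y → x ≤ y → y < n → P y ≡ true → P x ≡ true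

prefix-true : ∀ n P → DownClosed n P → ∀ x → x < n → P x ≡ true → x < cnt P n
prefix-true n P dc x x<n e =
  ≤-trans (≤-reflexive (sym (cnt-true (suc x) P (λ y p → dc y x (≤-pred p) x<n e))))
    (subst (cnt P (suc x) ≤_)
           (trans (sym (cnt-split (suc x) (n ∸ suc x) P)) (cong (cnt P) (m+[n∸m]≡n x<n)))
           (m≤m+n _ _))

prefix-false : ∀ n P → DownClosed n P → ∀ x → x < n → P x ≡ false → cnt P n ≤ x
prefix-false n P dc x x<n e =
  subst (_≤ x) (begin
      cnt P x                            ≡⟨ sym (+-identityʳ _) ⟩
      cnt P x + 0                        ≡⟨ cong (cnt P x +_) (sym (cnt-false (n ∸ x) _ beyond)) ⟩
      cnt P x + cnt (λ y → P (x + y)) (n ∸ x) ≡⟨ sym (cnt-split x (n ∸ x) P) ⟩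
      cnt P (x + (n ∸ x))                ≡⟨ cong (cnt P) (m+[n∸m]≡n (<⇒≤ x<n)) ⟩
      cnt P n ∎)
    (cnt-≤ x P)
  where
  open ≡-Reasoning
  beyond : ∀ y → y < n ∸ x → P (x + y) ≡ false
  beyond y p = ¬-not λ e' → true≢false (trans (sym (dc x (x + y) (m≤m+n x y) x+y<n e')) e)
    where
    x+y<n : x + y < n
    x+y<n = subst (x + y <_) (m+[n∸m]≡n (<⇒≤ x<n)) (+-monoʳ-< x p)

inPrefix : ∀ n P → DownClosed n P → ∀ x → x < n → x < cnt P n → P x ≡ true
inPrefix n P dc x x<n p with P x in e
... | true = refl
... | false = ⊥-elim (<⇒≱ p (prefix-false n P dc x x<n e))

outPrefix : ∀ n P → DownClosed n P → ∀ x → x < n → cnt P n ≤ x → P x ≡ false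
outPrefix n P dc x x<n p with P x in e
... | false = refl
... | true = ⊥-elim (<⇒≱ (prefix-true n P dc x x<n e) p)

-- Neighbourhoods are given as lists of vertex numbers.  The degree of a vertex
-- is then the length of its (duplicate-free, in-range) neighbour list.

elemB : ℕ → List ℕ → Bool
elemB y [] = false
elemB y (z ∷ L) = (y ≡ᵇ z) ∨ elemB y L

cntL : (ℕ → Bool) → List ℕ → ℕ
cntL Q [] = 0
cntL Q (z ∷ L) = b2n (Q z) + cntL Q L

Dist : List ℕ → Set
Dist [] = ⊤
Dist (z ∷ L) = (elemB z L ≡ false) × Dist L

Bnd : ℕ → List ℕ → Set
Bnd n [] = ⊤
Bnd n (z ∷ L) = z < n × Bnd n L

el-hd : ∀ y L → elemB y (y ∷ L) ≡ true
el-hd y L = ∨-l (y ≡ᵇ y) _ (≡ᵇ-refl y)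

el-tl : ∀ y z L → elemB y L ≡ true → elemB y (z ∷ L) ≡ true
el-tl y z L e = ∨-r (y ≡ᵇ z) _ e

elemB-++ : ∀ y L M → elemB y (L ++ M) ≡ (elemB y L ∨ elemB y M)
elemB-++ y [] M = refl
elemB-++ y (z ∷ L) M = trans (cong ((y ≡ᵇ z) ∨_) (elemB-++ y L M)) (sym (Bool.∨-assoc (y ≡ᵇ z) _ _))

el-++l : ∀ y L M → elemB y L ≡ true → elemB y (L ++ M) ≡ true
el-++l y L M e = trans (elemB-++ y L M) (∨-l _ _ e)

el-++r : ∀ y L M → elemB y M ≡ true → elemB y (L ++ M) ≡ true
el-++r y L M e = trans (elemB-++ y L M) (∨-r _ _ e)

elemB-none : ∀ y L → (∀ z → elemB z L ≡ true → y ≢ z) → elemB y L ≡ false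
elemB-none y [] h = refl
elemB-none y (z ∷ L) h rewrite ≡ᵇ-false y z (h z (el-hd z L)) = elemB-none y L (λ w e → h w (el-tl w z L e))

bnd-of : ∀ N L → (∀ z → elemB z L ≡ true → z < N) → Bnd N L
bnd-of N [] h = tt
bnd-of N (z ∷ L) h = h z (el-hd z L) , bnd-of N L (λ w e → h w (el-tl w z L e))

dist2 : ∀ {u v} → u ≢ v → Dist (u ∷ v ∷ [])
dist2 {u} {v} u≢v = trans (∨-identityʳ _) (≡ᵇ-false u v u≢v) , refl , tt

cnt-elem : ∀ n Q L → Dist L → Bnd n L → cnt (λ y → elemB y L ∧ Q y) n ≡ cntL Q L
cnt-elem n Q [] _ _ = cnt-false n _ (λ _ _ → refl)
cnt-elem n Q (z ∷ L) (z∉L , dl) (z<n , bl) = begin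
  cnt (λ y → ((y ≡ᵇ z) ∨ elemB y L) ∧ Q y) n
    ≡⟨ cnt-ext n (λ y _ → Bool.∧-distribʳ-∨ (Q y) (y ≡ᵇ z) (elemB y L)) ⟩
  cnt (λ y → ((y ≡ᵇ z) ∧ Q y) ∨ (elemB y L ∧ Q y)) n
    ≡⟨ cnt-or n _ _ disjoint ⟩
  cnt (λ y → (y ≡ᵇ z) ∧ Q y) n + cnt (λ y → elemB y L ∧ Q y) n
    ≡⟨ cong₂ _+_ (head (Q z) refl) (cnt-elem n Q L dl bl) ⟩
  b2n (Q z) + cntL Q L ∎
  where
  open ≡-Reasoning
  disjoint : ∀ y → y < n → ((y ≡ᵇ z) ∧ Q y) ≡ true → (elemB y L ∧ Q y) ≡ false
  disjoint y _ e with ∧-T (y ≡ᵇ z) _ e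
  ... | q , _ rewrite ≡ᵇ-true y z q | z∉L = refl
  at-z : ∀ y → ((y ≡ᵇ z) ∧ Q y) ≡ ((y ≡ᵇ z) ∧ Q z)
  at-z y with y ≡ᵇ z in eq
  ... | true rewrite ≡ᵇ-true y z eq = refl
  ... | false = refl
  head : ∀ b → Q z ≡ b → cnt (λ y → (y ≡ᵇ z) ∧ Q y) n ≡ b2n b
  head true qz = trans (cnt-ext n (λ y _ → trans (at-z y) (trans (cong ((y ≡ᵇ z) ∧_) qz) (∧-identityʳ _))))
                       (cnt-single n z z<n)
  head false qz = cnt-false n _ (λ y _ → trans (at-z y) (trans (cong ((y ≡ᵇ z) ∧_) qz) (∧-zeroʳ _)))

cntL-++ : ∀ Q L M → cntL Q (L ++ M) ≡ cntL Q L + cntL Q M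
cntL-++ Q [] M = refl
cntL-++ Q (z ∷ L) M rewrite cntL-++ Q L M = sym (+-assoc (b2n (Q z)) _ _)

Dist-++ : ∀ L M → Dist L → Dist M → (∀ y → elemB y L ≡ true → elemB y M ≡ false) → Dist (L ++ M)
Dist-++ [] M _ dm _ = dm
Dist-++ (z ∷ L) M (z∉L , dl) dm h = z∉L++M , Dist-++ L M dl dm (λ y q → h y (el-tl y z L q))
  where
  z∉L++M : elemB z (L ++ M) ≡ false
  z∉L++M rewrite elemB-++ z L M | z∉L = h z (el-hd z L)

rng : ℕ → ℕ → List ℕ
rng a zero = []
rng a (suc len) = a ∷ rng (suc a) len

rng-T : ∀ a len y → elemB y (rng a len) ≡ true → a ≤ y × y < a + len
rng-T a (suc len) y e with ∨-T (y ≡ᵇ a) _ e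
... | inj₁ q rewrite ≡ᵇ-true y a q = ≤-refl , m<m+n a z<s
... | inj₂ r with rng-T (suc a) len y r
...   | p , q = <⇒≤ p , subst (y <_) (sym (+-suc a len)) q

rng-I : ∀ a len y → a ≤ y → y < a + len → elemB y (rng a len) ≡ true
rng-I a zero y a≤y y<a = ⊥-elim (<⇒≱ (subst (y <_) (+-identityʳ a) y<a) a≤y)
rng-I a (suc len) y a≤y y<a+len with a ≟ y
... | yes refl = el-hd a (rng (suc a) len)
... | no a≢y = el-tl y a (rng (suc a) len) (rng-I (suc a) len y (≤∧≢⇒< a≤y a≢y) (subst (y <_) (+-suc a len) y<a+len))

rng-F : ∀ a len y → (y < a ⊎ a + len ≤ y) → elemB y (rng a len) ≡ false
rng-F a len y outside = ¬-not λ e → case (rng-T a len y e) outside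
  where
  case : a ≤ y × y < a + len → (y < a ⊎ a + len ≤ y) → ⊥
  case (p , q) (inj₁ r) = <⇒≱ r p
  case (p , q) (inj₂ r) = <⇒≱ q r

rng-Dist : ∀ a len → Dist (rng a len)
rng-Dist a zero = tt
rng-Dist a (suc len) = rng-F (suc a) len a (inj₁ ≤-refl) , rng-Dist (suc a) len

cntL-rng-true : ∀ Q a len → (∀ y → a ≤ y → y < a + len → Q y ≡ true) → cntL Q (rng a len) ≡ len
cntL-rng-true Q a zero h = refl
cntL-rng-true Q a (suc len) h rewrite h a ≤-refl (m<m+n a z<s) =
  cong suc (cntL-rng-true Q (suc a) len (λ y p q → h y (<⇒≤ p) (subst (y <_) (sym (+-suc a len)) q)))

cntL-rng-false : ∀ Q a len → (∀ y → a ≤ y → y < a + len → Q y ≡ false) → cntL Q (rng a len) ≡ 0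
cntL-rng-false Q a zero h = refl
cntL-rng-false Q a (suc len) h rewrite h a ≤-refl (m<m+n a z<s) =
  cntL-rng-false Q (suc a) len (λ y p q → h y (<⇒≤ p) (subst (y <_) (sym (+-suc a len)) q))

d3 : ℕ → ℕ
d3 (suc (suc (suc t))) = suc (d3 t)
d3 _ = 0

m3 : ℕ → ℕ
m3 (suc (suc (suc t))) = m3 t
m3 t = t

d2 : ℕ → ℕ
d2 (suc (suc t)) = suc (d2 t)
d2 _ = 0

m2 : ℕ → ℕ
m2 (suc (suc t)) = m2 t
m2 t = t

3*suc : ∀ q r → 3 * suc q + r ≡ suc (suc (suc (3 * q + r)))
3*suc = solve-∀

2*suc : ∀ q r → 2 * suc q + r ≡ suc (suc (2 * q + r))
2*suc = solve-∀

div-mod3 : ∀ t → 3 * d3 t + m3 t ≡ t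
div-mod3 zero = refl
div-mod3 (suc zero) = refl
div-mod3 (suc (suc zero)) = refl
div-mod3 (suc (suc (suc t))) = trans (3*suc (d3 t) (m3 t)) (cong (λ w → suc (suc (suc w))) (div-mod3 t))

div-mod2 : ∀ t → 2 * d2 t + m2 t ≡ t
div-mod2 zero = refl
div-mod2 (suc zero) = refl
div-mod2 (suc (suc t)) = trans (2*suc (d2 t) (m2 t)) (cong (λ w → suc (suc w)) (div-mod2 t))

d3-eq : ∀ q r → r < 3 → d3 (3 * q + r) ≡ q × m3 (3 * q + r) ≡ r
d3-eq zero zero _ = refl , refl
d3-eq zero (suc zero) _ = refl , refl
d3-eq zero (suc (suc zero)) _ = refl , refl
d3-eq zero (suc (suc (suc r))) (s≤s (s≤s (s≤s ())))
d3-eq (suc q) r p rewrite 3*suc q r with d3-eq q r p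
... | eq-q , eq-r = cong suc eq-q , eq-r

d2-eq : ∀ q r → r < 2 → d2 (2 * q + r) ≡ q × m2 (2 * q + r) ≡ r
d2-eq zero zero _ = refl , refl
d2-eq zero (suc zero) _ = refl , refl
d2-eq zero (suc (suc r)) (s≤s (s≤s ()))
d2-eq (suc q) r p rewrite 2*suc q r with d2-eq q r p
... | eq-q , eq-r = cong suc eq-q , eq-r

d3-mono : ∀ {u v} → u ≤ v → d3 u ≤ d3 v
d3-mono {zero} p = z≤n
d3-mono {suc zero} p = z≤n
d3-mono {suc (suc zero)} p = z≤n
d3-mono {suc (suc (suc u))} (s≤s (s≤s (s≤s p))) = s≤s (d3-mono p)

d2-mono : ∀ {u v} → u ≤ v → d2 u ≤ d2 v
d2-mono {zero} p = z≤n
d2-mono {suc zero} p = z≤n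
d2-mono {suc (suc u)} (s≤s (s≤s p)) = s≤s (d2-mono p)

d3-lt : ∀ q k → q < d3 k → 3 * q + 3 ≤ k
d3-lt q k p = begin
  3 * q + 3      ≡⟨ +-comm (3 * q) 3 ⟩
  3 + 3 * q      ≡⟨ sym (*-suc 3 q) ⟩
  3 * suc q      ≤⟨ *-monoʳ-≤ 3 p ⟩
  3 * d3 k       ≤⟨ m≤m+n (3 * d3 k) (m3 k) ⟩
  3 * d3 k + m3 k ≡⟨ div-mod3 k ⟩
  k ∎
  where open ≤-Reasoning

d2-lt : ∀ q k → q < d2 k → 2 * q + 2 ≤ k
d2-lt q k p = begin
  2 * q + 2      ≡⟨ +-comm (2 * q) 2 ⟩
  2 + 2 * q      ≡⟨ sym (*-suc 2 q) ⟩
  2 * suc q      ≤⟨ *-monoʳ-≤ 2 p ⟩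
  2 * d2 k       ≤⟨ m≤m+n (2 * d2 k) (m2 k) ⟩
  2 * d2 k + m2 k ≡⟨ div-mod2 k ⟩
  k ∎
  where open ≤-Reasoning

lt-d3 : ∀ q k → 3 * q + 3 ≤ k → q < d3 k
lt-d3 q k p = subst (_≤ d3 k) (proj₁ (d3-eq (suc q) 0 z<s))
                (d3-mono (subst (_≤ k) (eq q) p))
  where
  eq : ∀ q → 3 * q + 3 ≡ 3 * suc q + 0
  eq = solve-∀

lt-d2 : ∀ q k → 2 * q + 2 ≤ k → q < d2 k
lt-d2 q k p = subst (_≤ d2 k) (proj₁ (d2-eq (suc q) 0 z<s))
                (d2-mono (subst (_≤ k) (eq q) p))
  where
  eq : ∀ q → 2 * q + 2 ≡ 2 * suc q + 0
  eq = solve-∀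

d3-div : ∀ x → d3 x ≡ x / 3
d3-div zero = refl
d3-div (suc zero) = refl
d3-div (suc (suc zero)) = refl
d3-div (suc (suc (suc t))) = trans (cong suc (d3-div t)) (sym (m/n≡1+[m∸n]/n {suc (suc (suc t))} {3} (s≤s (s≤s (s≤s z≤n)))))

d2-div : ∀ x → d2 x ≡ x / 2
d2-div zero = refl
d2-div (suc zero) = refl
d2-div (suc (suc t)) = trans (cong suc (d2-div t)) (sym (m/n≡1+[m∸n]/n {suc (suc t)} {2} (s≤s (s≤s z≤n))))

d3-add : ∀ q r → d3 (3 * q + r) ≡ q + d3 r
d3-add zero r = refl
d3-add (suc q) r rewrite 3*suc q r = cong suc (d3-add q r)

d2-add : ∀ q r → d2 (2 * q + r) ≡ q + d2 r
d2-add zero r = refl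
d2-add (suc q) r rewrite 2*suc q r = cong suc (d2-add q r)

m3-cases : ∀ t → m3 t ≡ 0 ⊎ m3 t ≡ 1 ⊎ m3 t ≡ 2
m3-cases zero = inj₁ refl
m3-cases (suc zero) = inj₂ (inj₁ refl)
m3-cases (suc (suc zero)) = inj₂ (inj₂ refl)
m3-cases (suc (suc (suc t))) = m3-cases t

m3-pred : ∀ t → m3 (suc t) ≡ 0 → m3 t ≡ 2
m3-pred (suc (suc zero)) _ = refl
m3-pred (suc (suc (suc t))) e = m3-pred t e

m3-next : ∀ t → m3 t ≡ 1 → m3 (suc t) ≡ 2
m3-next (suc zero) _ = refl
m3-next (suc (suc (suc t))) e = m3-next t e

m2-next : ∀ t → m2 t ≡ 0 → m2 (suc t) ≡ 1
m2-next zero _ = refl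
m2-next (suc (suc t)) e = m2-next t e

d2-close : ∀ u v → d2 u ≡ d2 v → u ≡ v ⊎ u ≡ suc v ⊎ v ≡ suc u
d2-close zero zero _ = inj₁ refl
d2-close zero (suc zero) _ = inj₂ (inj₂ refl)
d2-close (suc zero) zero _ = inj₂ (inj₁ refl)
d2-close (suc zero) (suc zero) _ = inj₁ refl
d2-close (suc (suc u)) (suc (suc v)) e with d2-close u v (suc-injective e)
... | inj₁ r = inj₁ (cong (λ w → suc (suc w)) r)
... | inj₂ (inj₁ r) = inj₂ (inj₁ (cong (λ w → suc (suc w)) r))
... | inj₂ (inj₂ r) = inj₂ (inj₂ (cong (λ w → suc (suc w)) r))

reach-++ : ∀ {n} {G : Graph n} {u v w} → Reach G u v → Reach G v w → Reach G u w
reach-++ here r = r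
reach-++ (step e r) r' = step e (reach-++ r r')

reach-rev : ∀ {n} {G : Graph n} {u v} → Reach G u v → Reach G v u
reach-rev here = here
reach-rev {G = G} (step {u} {w} e r) = reach-++ (reach-rev r) (step (trans (sym (Graph.sym G u w)) e) here)

argmax : ∀ {N} (f : Fin (suc N) → ℕ) → ∃ λ i → ∀ j → f j ≤ f i
argmax {zero} f = fzero , λ { fzero → ≤-refl }
argmax {suc N} f with argmax (λ i → f (fsuc i))
... | i , h with f fzero ≤? f (fsuc i)
...   | yes p = fsuc i , λ { fzero → p ; (fsuc j) → h j }
...   | no p = fzero , λ { fzero → ≤-refl ; (fsuc j) → ≤-trans (h j) (<⇒≤ (≰⇒> p)) }

data LastView : ∀ {N} → Fin (suc N) → Set where
  isLast : ∀ {N} → LastView (fromℕ N)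
  notLast : ∀ {N} (i : Fin N) → LastView (inject₁ i)

lastView : ∀ {N} (i : Fin (suc N)) → LastView i
lastView {zero} fzero = isLast
lastView {suc N} fzero = notLast fzero
lastView {suc N} (fsuc i) with lastView i
... | isLast = isLast
... | notLast j = notLast (fsuc j)

cycle-two-nbrs : ∀ {n} (G : Graph n) K (p : Fin (suc (suc (suc K))) → Fin n)
  → (∀ (i : Fin (suc (suc K))) → adj G (p (inject₁ i)) (p (fsuc i)) ≡ true)
  → adj G (p (fromℕ (suc (suc K)))) (p fzero) ≡ true
  → ∀ i → ∃ λ j₁ → ∃ λ j₂ → adj G (p i) (p j₁) ≡ true × adj G (p i) (p j₂) ≡ true × toℕ j₁ ≢ toℕ j₂
cycle-two-nbrs G K p consecutive closing i with lastView i
... | isLast = fzero , inject₁ (fromℕ (suc K)) , closing , trans (Graph.sym G _ _) (consecutive (fromℕ (suc K))) , 0≢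
  where
  0≢ : 0 ≢ toℕ (inject₁ (fromℕ (suc K)))
  0≢ e with trans e (trans (toℕ-inject₁ (fromℕ (suc K))) (toℕ-fromℕ (suc K)))
  ... | ()
... | notLast fzero = fsuc fzero , fromℕ (suc (suc K)) , consecutive fzero , trans (Graph.sym G _ _) closing , 1≢
  where
  1≢ : 1 ≢ toℕ (fromℕ (suc (suc K)))
  1≢ e with trans e (toℕ-fromℕ (suc (suc K)))
  ... | ()
... | notLast (fsuc j) = fsuc (fsuc j) , inject₁ (inject₁ j) , consecutive (fsuc j)
                        , trans (Graph.sym G _ _) (consecutive (inject₁ j)) , ≢
  where
  ≢ : suc (suc (toℕ j)) ≢ toℕ (inject₁ (inject₁ j))
  ≢ e = <-irrefl (sym (trans e (trans (toℕ-inject₁ (inject₁ j)) (toℕ-inject₁ j)))) (≤-trans (n<1+n (toℕ j)) (n≤1+n _))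

-- surplus dd i = Σ_{x<i} (dd x − 3): the number of pendant vertices hanging
-- off the first i (big) vertices in the construction
surplus : (ℕ → ℕ) → ℕ → ℕ
surplus dd zero = 0
surplus dd (suc i) = surplus dd i + (dd i ∸ 3)

sum-via-surplus : ∀ dd B → (∀ x → x < B → 3 ≤ dd x) → sumN dd B ≡ surplus dd B + 3 * B
sum-via-surplus dd zero h = refl
sum-via-surplus dd (suc B) h = begin
  sumN dd (suc B)                               ≡⟨ sumN-snoc B dd ⟩
  sumN dd B + dd B                              ≡⟨ cong (_+ dd B) (sum-via-surplus dd B (λ x p → h x (m<n⇒m<1+n p))) ⟩
  surplus dd B + 3 * B + dd B                   ≡⟨ cong (surplus dd B + 3 * B +_) (sym (m∸n+n≡m (h B ≤-refl))) ⟩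
  surplus dd B + 3 * B + ((dd B ∸ 3) + 3)       ≡⟨ regroup (surplus dd B) B (dd B ∸ 3) ⟩
  surplus dd B + (dd B ∸ 3) + 3 * suc B         ∎
  where
  open ≡-Reasoning
  regroup : ∀ q b u → q + 3 * b + (u + 3) ≡ q + u + 3 * suc b
  regroup = solve-∀

-- The forest for b big vertices, a path of k vertices, cm = c − 1 extra
-- components, and a degree function dd on ℕ (used for the big vertices).
module Construction (b k cm : ℕ) (dd : ℕ → ℕ) where

  -- Layout of the vertex set [0, n) (all intervals half-open):
  --   [0, b)             big vertices (degree ≥ 3), the start of the spine
  --   [b, s), s = b + k  path vertices (degree 2), the rest of the spine
  --   s, s + 1           head and tail of the spine (degree 2)
  --   [pend₀, root₀)     pendant vertices: dd x − 3 of them hang off big vertex x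
  --   [root₀, child₀)    roots of the cm extra components ...
  --   [child₀, m)        ... and their children (each extra component is a P₄)
  --   [m, n)             leaves, one attached to every support vertex.
  -- The spine is the path  s — 0 — 1 — ⋯ — (s − 1) — (s + 1).

  Q : ℕ → ℕ
  Q = surplus dd

  pendCount : ℕ
  pendCount = Q b

  s pend₀ root₀ child₀ m a l n : ℕ
  s = b + k
  pend₀ = suc (suc s)
  root₀ = pend₀ + pendCount
  child₀ = root₀ + cm
  m = child₀ + cm
  -- supports other than big vertices: head, tail, pendants, roots, children
  a = suc (suc ((pendCount + cm) + cm))
  -- supports (= leaves)
  l = b + a
  n = m + l

  -- the leaf of support j, and the support of leaf number t (the leaf m + t)
  leafOf : ℕ → ℕ
  leafOf j = if j <ᵇ b then m + j else m + (j ∸ k)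

  supportOf : ℕ → ℕ
  supportOf t = if t <ᵇ b then t else t + k

  -- the big vertex carrying pendant number t: the i with Q i ≤ t < Q (i + 1),
  -- found by linear search among i ∈ [j, j + f)
  findBlock : ℕ → ℕ → ℕ → ℕ
  findBlock t j zero = j
  findBlock t j (suc f) = if t <ᵇ Q (suc j) then j else findBlock t (suc j) f

  pendParent : ℕ → ℕ
  pendParent t = findBlock t 0 b

  data Kind : Set where
    Big Path Head Tail Pend Root Child Leaf : Kind

  kind : ℕ → Kind
  kind x = if x <ᵇ b then Big else if x <ᵇ s then Path else if x <ᵇ suc s then Head
           else if x <ᵇ pend₀ then Tail else if x <ᵇ root₀ then Pend else if x <ᵇ child₀ then Root
           else if x <ᵇ m then Child else Leaf

  spineNext : ℕ → ℕ
  spineNext x = if suc x <ᵇ s then suc x else suc s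

  spineParent : ℕ → ℕ
  spineParent x = if x ≡ᵇ 0 then s else pred x

  spineFirst : ℕ
  spineFirst = if 0 <ᵇ s then 0 else suc s

  -- F is built as a rooted forest (roots: the head and the roots of the extra
  -- components); every other vertex has exactly one parent.
  parents : Kind → ℕ → List ℕ
  parents Big x = spineParent x ∷ []
  parents Path x = spineParent x ∷ []
  parents Head x = []
  parents Tail x = pred s ∷ []
  parents Pend x = pendParent (x ∸ pend₀) ∷ []
  parents Root x = []
  parents Child x = x ∸ cm ∷ []
  parents Leaf x = supportOf (x ∸ m) ∷ []

  pendantsOf : ℕ → List ℕ
  pendantsOf x = rng (pend₀ + Q x) (dd x ∸ 3)

  children : Kind → ℕ → List ℕ
  children Big x = spineNext x ∷ (pendantsOf x ++ (leafOf x ∷ []))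
  children Path x = spineNext x ∷ []
  children Head x = spineFirst ∷ leafOf x ∷ []
  children Tail x = leafOf x ∷ []
  children Pend x = leafOf x ∷ []
  children Root x = x + cm ∷ leafOf x ∷ []
  children Child x = leafOf x ∷ []
  children Leaf x = []

  nbrs : ℕ → List ℕ
  nbrs x = parents (kind x) x ++ children (kind x) x

  adjN : ℕ → ℕ → Bool
  adjN x y = elemB y (nbrs x)

  b≤s : b ≤ s
  b≤s = m≤m+n b k

  s≤pend₀ : s ≤ pend₀
  s≤pend₀ = m≤n⇒m≤1+n (n≤1+n s)

  pend₀≤root₀ : pend₀ ≤ root₀
  pend₀≤root₀ = m≤m+n pend₀ pendCount

  root₀≤child₀ : root₀ ≤ child₀
  root₀≤child₀ = m≤m+n root₀ cm

  child₀≤m : child₀ ≤ m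
  child₀≤m = m≤m+n child₀ cm

  m≤n : m ≤ n
  m≤n = m≤m+n m l

  pend₀≤m : pend₀ ≤ m
  pend₀≤m = ≤-trans pend₀≤root₀ (≤-trans root₀≤child₀ child₀≤m)

  m≡s+a : m ≡ s + a
  m≡s+a = regroup s pendCount cm
    where
    regroup : ∀ s q c → suc (suc (((s + q) + c) + c)) ≡ s + suc (suc ((q + c) + c))
    regroup = solve-∀

  n≡k+l+l : n ≡ k + l + l
  n≡k+l+l = regroup b k pendCount cm
    where
    regroup : ∀ b k q c → suc (suc ((((b + k) + q) + c) + c)) + (b + suc (suc ((q + c) + c)))
                        ≡ k + (b + suc (suc ((q + c) + c))) + (b + suc (suc ((q + c) + c)))
    regroup = solve-∀

  kind-Big : ∀ {x} → x < b → kind x ≡ Big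
  kind-Big {x} x<b rewrite <ᵇ-true x b x<b = refl

  kind-Path : ∀ {x} → b ≤ x → x < s → kind x ≡ Path
  kind-Path {x} b≤x x<s rewrite <ᵇ-false x b b≤x | <ᵇ-true x s x<s = refl

  kind-Head : kind s ≡ Head
  kind-Head rewrite <ᵇ-false s b b≤s | <ᵇ-false s s ≤-refl | <ᵇ-true s (suc s) ≤-refl = refl

  kind-Tail : kind (suc s) ≡ Tail
  kind-Tail rewrite <ᵇ-false (suc s) b (m≤n⇒m≤1+n b≤s) | <ᵇ-false (suc s) s (n≤1+n s)
                  | <ᵇ-false (suc s) (suc s) ≤-refl | <ᵇ-true (suc s) pend₀ ≤-refl = refl

  kind-beyond : ∀ {x} (u : Kind) → pend₀ ≤ x
              → (if x <ᵇ root₀ then Pend else if x <ᵇ child₀ then Root else if x <ᵇ m then Child else Leaf) ≡ u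
              → kind x ≡ u
  kind-beyond {x} u p e
    rewrite <ᵇ-false x b (≤-trans (≤-trans b≤s s≤pend₀) p) | <ᵇ-false x s (≤-trans s≤pend₀ p)
          | <ᵇ-false x (suc s) (≤-trans (n≤1+n (suc s)) p) | <ᵇ-false x pend₀ p = e

  kind-Pend : ∀ {x} → pend₀ ≤ x → x < root₀ → kind x ≡ Pend
  kind-Pend {x} p q = kind-beyond Pend p (if-t _ _ (<ᵇ-true x root₀ q))

  kind-Root : ∀ {x} → root₀ ≤ x → x < child₀ → kind x ≡ Root
  kind-Root {x} p q = kind-beyond Root (≤-trans pend₀≤root₀ p)
    (trans (if-f _ _ (<ᵇ-false x root₀ p)) (if-t _ _ (<ᵇ-true x child₀ q)))

  kind-Child : ∀ {x} → child₀ ≤ x → x < m → kind x ≡ Child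
  kind-Child {x} p q = kind-beyond Child (≤-trans (≤-trans pend₀≤root₀ root₀≤child₀) p)
    (trans (if-f _ _ (<ᵇ-false x root₀ (≤-trans root₀≤child₀ p)))
           (trans (if-f _ _ (<ᵇ-false x child₀ p)) (if-t _ _ (<ᵇ-true x m q))))

  kind-Leaf : ∀ {x} → m ≤ x → kind x ≡ Leaf
  kind-Leaf {x} p = kind-beyond Leaf (≤-trans pend₀≤m p)
    (trans (if-f _ _ (<ᵇ-false x root₀ (≤-trans (≤-trans root₀≤child₀ child₀≤m) p)))
           (trans (if-f _ _ (<ᵇ-false x child₀ (≤-trans child₀≤m p))) (if-f _ _ (<ᵇ-false x m p))))

  data KindView (x : ℕ) : Set where
    vBig : kind x ≡ Big → x < b → KindView x
    vPath : kind x ≡ Path → b ≤ x → x < s → KindView x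
    vHead : kind x ≡ Head → x ≡ s → KindView x
    vTail : kind x ≡ Tail → x ≡ suc s → KindView x
    vPend : kind x ≡ Pend → pend₀ ≤ x → x < root₀ → KindView x
    vRoot : kind x ≡ Root → root₀ ≤ x → x < child₀ → KindView x
    vChild : kind x ≡ Child → child₀ ≤ x → x < m → KindView x
    vLeaf : kind x ≡ Leaf → m ≤ x → KindView x

  kindView : ∀ x → KindView x
  kindView x with x <? b
  ... | yes x<b = vBig (kind-Big x<b) x<b
  ... | no x≮b with x <? s
  ...   | yes x<s = vPath (kind-Path (≮⇒≥ x≮b) x<s) (≮⇒≥ x≮b) x<s
  ...   | no x≮s with x <? suc s
  ...     | yes x<1+s = vHead (subst (λ y → kind y ≡ Head) (sym x≡s) kind-Head) x≡s
    where
    x≡s : x ≡ s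
    x≡s = ≤-antisym (≤-pred x<1+s) (≮⇒≥ x≮s)
  ...     | no x≮1+s with x <? pend₀
  ...       | yes x<pend₀ = vTail (subst (λ y → kind y ≡ Tail) (sym x≡1+s) kind-Tail) x≡1+s
    where
    x≡1+s : x ≡ suc s
    x≡1+s = ≤-antisym (≤-pred x<pend₀) (≮⇒≥ x≮1+s)
  ...       | no x≮pend₀ with x <? root₀
  ...         | yes x<root₀ = vPend (kind-Pend (≮⇒≥ x≮pend₀) x<root₀) (≮⇒≥ x≮pend₀) x<root₀
  ...         | no x≮root₀ with x <? child₀
  ...           | yes x<child₀ = vRoot (kind-Root (≮⇒≥ x≮root₀) x<child₀) (≮⇒≥ x≮root₀) x<child₀
  ...           | no x≮child₀ with x <? m
  ...             | yes x<m = vChild (kind-Child (≮⇒≥ x≮child₀) x<m) (≮⇒≥ x≮child₀) x<m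
  ...             | no x≮m = vLeaf (kind-Leaf (≮⇒≥ x≮m)) (≮⇒≥ x≮m)

  surplus-mono : ∀ {i j} → i ≤ j → Q i ≤ Q j
  surplus-mono {i} {zero} z≤n = ≤-refl
  surplus-mono {i} {suc j} p with m≤n⇒m<n∨m≡n p
  ... | inj₁ (s≤s i≤j) = ≤-trans (surplus-mono i≤j) (m≤m+n (Q j) _)
  ... | inj₂ refl = ≤-refl

  findBlock-correct : ∀ f j t i → j ≤ i → i < j + f → Q i ≤ t → t < Q (suc i) → findBlock t j f ≡ i
  findBlock-correct zero j t i p q r u = ⊥-elim (<⇒≱ (subst (i <_) (+-identityʳ j) q) p)
  findBlock-correct (suc f) j t i p q r u with t <ᵇ Q (suc j) in e | m≤n⇒m<n∨m≡n p
  ... | true | inj₂ j≡i = j≡i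
  ... | true | inj₁ j<i = ⊥-elim (<⇒≱ (<ᵇ-T _ _ e) (≤-trans (surplus-mono j<i) r))
  ... | false | inj₂ refl = ⊥-elim (<⇒≱ u (<ᵇ-F _ _ e))
  ... | false | inj₁ j<i = findBlock-correct f (suc j) t i j<i (subst (i <_) (+-suc j f) q) r u

  pendParent-correct : ∀ t i → i < b → Q i ≤ t → t < Q (suc i) → pendParent t ≡ i
  pendParent-correct t i i<b = findBlock-correct b 0 t i z≤n i<b

  block-exists : ∀ B t → t < Q B → ∃ λ i → i < B × Q i ≤ t × t < Q (suc i)
  block-exists (suc B) t p with t <ᵇ Q B in e
  ... | false = B , ≤-refl , <ᵇ-F _ _ e , p
  ... | true with block-exists B t (<ᵇ-T _ _ e)
  ...   | i , i<B , lo , hi = i , m≤n⇒m≤1+n i<B , lo , hi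

  <-∸ : ∀ {x u v} → x < u + v → v ≤ x → x ∸ v < u
  <-∸ {x} {u} {v} p q = subst (x ∸ v <_) (m+n∸n≡m u v) (∸-monoˡ-< p q)

  pendant-block : ∀ {x} → pend₀ ≤ x → x < root₀ → ∃ λ i → i < b × Q i ≤ x ∸ pend₀ × x ∸ pend₀ < Q (suc i)
  pendant-block {x} p q = block-exists b (x ∸ pend₀) (<-∸ (subst (x <_) (+-comm pend₀ pendCount) q) p)

  pendParent<b : ∀ {x} → pend₀ ≤ x → x < root₀ → pendParent (x ∸ pend₀) < b
  pendParent<b p q with pendant-block p q
  ... | i , i<b , lo , hi rewrite pendParent-correct _ i i<b lo hi = i<b

  IsSupport : ℕ → Set
  IsSupport y = y < b ⊎ (s ≤ y × y < m)

  support-beyond : ∀ {y} → pend₀ ≤ y → y < m → IsSupport y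
  support-beyond p q = inj₂ (≤-trans s≤pend₀ p , q)

  s<m : s < m
  s<m = ≤-trans (n≤1+n (suc s)) pend₀≤m

  1+s<m : suc s < m
  1+s<m = pend₀≤m

  support-head : IsSupport s
  support-head = inj₂ (≤-refl , s<m)

  support-tail : IsSupport (suc s)
  support-tail = inj₂ (n≤1+n s , 1+s<m)

  support<m : ∀ {x} → IsSupport x → x < m
  support<m (inj₁ x<b) = ≤-trans x<b (≤-trans b≤s (≤-trans s≤pend₀ pend₀≤m))
  support<m (inj₂ (_ , x<m)) = x<m

  support-not-path : ∀ {x} → IsSupport x → b ≤ x → x < s → ⊥
  support-not-path (inj₁ x<b) b≤x x<s = <⇒≱ x<b b≤x
  support-not-path (inj₂ (s≤x , _)) b≤x x<s = <⇒≱ x<s s≤x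

  leafOf-big : ∀ {y} → y < b → leafOf y ≡ m + y
  leafOf-big {y} p = if-t _ _ (<ᵇ-true y b p)

  leafOf-other : ∀ {y} → b ≤ y → leafOf y ≡ m + (y ∸ k)
  leafOf-other {y} p = if-f _ _ (<ᵇ-false y b p)

  supportOf-big : ∀ {t} → t < b → supportOf t ≡ t
  supportOf-big {t} p = if-t _ _ (<ᵇ-true t b p)

  supportOf-other : ∀ {t} → b ≤ t → supportOf t ≡ t + k
  supportOf-other {t} p = if-f _ _ (<ᵇ-false t b p)

  -- supports beyond the spine start are shifted by k when numbering leaves
  s≤⇒k≤ : ∀ {y} → s ≤ y → k ≤ y
  s≤⇒k≤ {y} p = ≤-trans (m≤n+m k b) p

  s≤⇒b≤∸k : ∀ {y} → s ≤ y → b ≤ y ∸ k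
  s≤⇒b≤∸k {y} p = subst (_≤ y ∸ k) (m+n∸n≡m b k) (∸-monoˡ-≤ k p)

  m-k≡l : m ∸ k ≡ l
  m-k≡l = begin
    m ∸ k           ≡⟨ cong (_∸ k) (trans m≡s+a (+-assoc b k a)) ⟩
    b + (k + a) ∸ k ≡⟨ cong (λ z → b + z ∸ k) (+-comm k a) ⟩
    b + (a + k) ∸ k ≡⟨ cong (_∸ k) (sym (+-assoc b a k)) ⟩
    b + a + k ∸ k   ≡⟨ m+n∸n≡m l k ⟩
    l ∎
    where open ≡-Reasoning

  l+k≡m : l + k ≡ m
  l+k≡m = trans (cong (_+ k) (sym m-k≡l)) (m∸n+n≡m (s≤⇒k≤ (<⇒≤ s<m)))

  m≤leafOf : ∀ y → m ≤ leafOf y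
  m≤leafOf y with y <ᵇ b
  ... | true = m≤m+n m y
  ... | false = m≤m+n m (y ∸ k)

  leafOf<n : ∀ {y} → IsSupport y → leafOf y < n
  leafOf<n (inj₁ p) rewrite leafOf-big p = +-monoʳ-< m (≤-trans p (m≤m+n b a))
  leafOf<n {y} (inj₂ (p , q)) rewrite leafOf-other (≤-trans b≤s p) =
    +-monoʳ-< m (subst (y ∸ k <_) m-k≡l (∸-monoˡ-< q (s≤⇒k≤ p)))

  supportOf-supp : ∀ {t} → t < l → IsSupport (supportOf t) × leafOf (supportOf t) ≡ m + t
  supportOf-supp {t} p with t <? b
  ... | yes t<b rewrite supportOf-big t<b = inj₁ t<b , leafOf-big t<b
  ... | no t≮b rewrite supportOf-other (≮⇒≥ t≮b) =
          inj₂ (+-monoˡ-≤ k (≮⇒≥ t≮b) , t+k<m)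
        , trans (leafOf-other (≤-trans (≮⇒≥ t≮b) (m≤m+n t k))) (cong (m +_) (m+n∸n≡m t k))
    where
    t+k<m : t + k < m
    t+k<m = subst (t + k <_) l+k≡m (+-monoˡ-< k p)

  IsParent : ℕ → ℕ → Set
  IsParent x y = parents (kind x) x ≡ y ∷ []

  IsChild : ℕ → ℕ → Set
  IsChild x y = elemB y (children (kind x) x) ≡ true

  parent-at : ∀ {x y z} → y ≡ z → IsParent z x → IsParent y x
  parent-at refl h = h

  child-at : ∀ {x y z} → y ≡ z → IsChild z x → IsChild y x
  child-at refl h = h

  suc-pred′ : ∀ u → u ≢ 0 → suc (pred u) ≡ u
  suc-pred′ zero u≢0 = ⊥-elim (u≢0 refl)
  suc-pred′ (suc u) _ = refl

  spine-parent : ∀ {y} → y < s → IsParent y (spineParent y)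
  spine-parent {y} p with y <? b
  ... | yes q rewrite kind-Big q = refl
  ... | no q rewrite kind-Path (≮⇒≥ q) p = refl

  spine-child : ∀ {y} → y < s → IsChild y (spineNext y)
  spine-child {y} p with y <? b
  ... | yes q rewrite kind-Big q = el-hd (spineNext y) (pendantsOf y ++ (leafOf y ∷ []))
  ... | no q rewrite kind-Path (≮⇒≥ q) p = el-hd (spineNext y) []

  spineNext-inside : ∀ {x} → suc x < s → spineNext x ≡ suc x
  spineNext-inside {x} q = if-t (suc x) (suc s) (<ᵇ-true _ _ q)

  spineNext-end : ∀ {x} → s ≤ suc x → spineNext x ≡ suc s
  spineNext-end {x} q = if-f (suc x) (suc s) (<ᵇ-false _ _ q)

  spineFirst-0 : 0 < s → spineFirst ≡ 0
  spineFirst-0 p = if-t _ _ (<ᵇ-true 0 s p)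

  spineFirst-tail : s ≡ 0 → spineFirst ≡ suc s
  spineFirst-tail p = if-f _ _ (<ᵇ-false 0 s (≤-reflexive p))

  spineNext-parent : ∀ {x} → x < s → IsParent (spineNext x) x
  spineNext-parent {x} p with suc x <? s
  ... | yes q rewrite spineNext-inside q = spine-parent q
  ... | no q rewrite spineNext-end (≮⇒≥ q) | kind-Tail = cong (_∷ []) (cong pred (sym (≤-antisym p (≮⇒≥ q))))

  spineFirst-parent : IsParent spineFirst s
  spineFirst-parent with 0 <? s
  ... | yes q rewrite spineFirst-0 q = spine-parent q
  ... | no q rewrite spineFirst-tail (n≤0⇒n≡0 (≮⇒≥ q)) | kind-Tail =
          cong (_∷ []) (trans (cong pred s≡0) (sym s≡0))
    where
    s≡0 : s ≡ 0
    s≡0 = n≤0⇒n≡0 (≮⇒≥ q)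

  spineParent-child : ∀ {x} → x < s → IsChild (spineParent x) x
  spineParent-child {zero} p rewrite kind-Head | spineFirst-0 p = el-hd 0 (leafOf s ∷ [])
  spineParent-child {suc x} p = subst (IsChild x) (spineNext-inside p) (spine-child (<-trans (n<1+n x) p))

  -- the tail is a child of pred s (the head when s = 0)
  tail-child : IsChild (pred s) (suc s)
  tail-child with s ≟ 0
  ... | yes s≡0 = child-at (trans (cong pred s≡0) (sym s≡0)) head-child
    where
    head-child : IsChild s (suc s)
    head-child rewrite kind-Head | spineFirst-tail s≡0 = el-hd (suc s) (leafOf s ∷ [])
  ... | no s≢0 = subst (IsChild (pred s)) (spineNext-end (≤-reflexive (sym (suc-pred′ s s≢0))))
                   (spine-child (≤-reflexive (suc-pred′ s s≢0)))

  pendant-parent : ∀ {x y} → x < b → elemB y (pendantsOf x) ≡ true → IsParent y x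
  pendant-parent {x} {y} x<b h with rng-T _ _ y h
  ... | lo , hi = subst (λ c → parents c y ≡ x ∷ []) (sym (kind-Pend pend₀≤y (<-≤-trans hi′ (+-monoʳ-≤ pend₀ (surplus-mono x<b)))))
                    (cong (_∷ []) (pendParent-correct (y ∸ pend₀) x x<b lo′ hi″))
    where
    pend₀≤y : pend₀ ≤ y
    pend₀≤y = ≤-trans (m≤m+n pend₀ (Q x)) lo
    hi′ : y < pend₀ + Q (suc x)
    hi′ = subst (y <_) (+-assoc pend₀ (Q x) _) hi
    lo′ : Q x ≤ y ∸ pend₀
    lo′ = subst (_≤ y ∸ pend₀) (m+n∸m≡n pend₀ (Q x)) (∸-monoˡ-≤ pend₀ lo)
    hi″ : y ∸ pend₀ < Q (suc x)
    hi″ = +-cancelˡ-< pend₀ _ _ (subst (_< pend₀ + Q (suc x)) (sym (m+[n∸m]≡n pend₀≤y)) hi′)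

  parents-Leaf : ∀ {z} → m ≤ z → IsParent z (supportOf (z ∸ m))
  parents-Leaf p rewrite kind-Leaf p = refl

  leaf-parent : ∀ {y} → IsSupport y → IsParent (leafOf y) y
  leaf-parent {y} (inj₁ p) rewrite leafOf-big p | parents-Leaf (m≤m+n m y) | m+n∸m≡n m y | supportOf-big p = refl
  leaf-parent {y} (inj₂ (p , q)) rewrite leafOf-other (≤-trans b≤s p) | parents-Leaf (m≤m+n m (y ∸ k))
                                    | m+n∸m≡n m (y ∸ k) | supportOf-other (s≤⇒b≤∸k p) =
    cong (_∷ []) (m∸n+n≡m (s≤⇒k≤ p))

  leaf-child : ∀ {y} → IsSupport y → IsChild y (leafOf y)
  leaf-child {y} sp with kindView y
  ... | vBig e p rewrite e = el-tl (leafOf y) (spineNext y) (pendantsOf y ++ (leafOf y ∷ []))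
                                (el-++r (leafOf y) (pendantsOf y) (leafOf y ∷ []) (el-hd (leafOf y) []))
  ... | vPath e p q = ⊥-elim (support-not-path sp p q)
  ... | vHead e p rewrite e = el-tl (leafOf y) spineFirst (leafOf y ∷ []) (el-hd (leafOf y) [])
  ... | vTail e p rewrite e = el-hd (leafOf y) []
  ... | vPend e p q rewrite e = el-hd (leafOf y) []
  ... | vRoot e p q rewrite e = el-tl (leafOf y) (y + cm) (leafOf y ∷ []) (el-hd (leafOf y) [])
  ... | vChild e p q rewrite e = el-hd (leafOf y) []
  ... | vLeaf e p = ⊥-elim (<⇒≱ (support<m sp) p)

  child⇒parent : ∀ x y → IsChild x y → IsParent y x
  child⇒parent x y h with kindView x
  ... | vBig e p with ∨-T (y ≡ᵇ spineNext x) _ (subst (λ c → elemB y (children c x) ≡ true) e h)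
  ...   | inj₁ q = parent-at (≡ᵇ-true _ _ q) (spineNext-parent (≤-trans p b≤s))
  ...   | inj₂ q with ∨-T (elemB y (pendantsOf x)) _ (trans (sym (elemB-++ y (pendantsOf x) (leafOf x ∷ []))) q)
  ...     | inj₁ r = pendant-parent p r
  ...     | inj₂ r = parent-at (≡ᵇ-true _ _ (trans (sym (∨-identityʳ _)) r)) (leaf-parent (inj₁ p))
  child⇒parent x y h | vPath e p q with ∨-T (y ≡ᵇ spineNext x) _ (subst (λ c → elemB y (children c x) ≡ true) e h)
  ... | inj₁ r = parent-at (≡ᵇ-true _ _ r) (spineNext-parent q)
  child⇒parent x y h | vHead e refl with ∨-T (y ≡ᵇ spineFirst) _ (subst (λ c → elemB y (children c s) ≡ true) e h)
  ... | inj₁ r = parent-at (≡ᵇ-true _ _ r) spineFirst-parent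
  ... | inj₂ r with ∨-T (y ≡ᵇ leafOf s) _ r
  ...   | inj₁ u = parent-at (≡ᵇ-true _ _ u) (leaf-parent support-head)
  child⇒parent x y h | vTail e refl with ∨-T (y ≡ᵇ leafOf (suc s)) _ (subst (λ c → elemB y (children c (suc s)) ≡ true) e h)
  ... | inj₁ u = parent-at (≡ᵇ-true _ _ u) (leaf-parent support-tail)
  child⇒parent x y h | vPend e p q with ∨-T (y ≡ᵇ leafOf x) _ (subst (λ c → elemB y (children c x) ≡ true) e h)
  ... | inj₁ u = parent-at (≡ᵇ-true _ _ u) (leaf-parent (support-beyond p (≤-trans q (≤-trans root₀≤child₀ child₀≤m))))
  child⇒parent x y h | vRoot e p q with ∨-T (y ≡ᵇ x + cm) _ (subst (λ c → elemB y (children c x) ≡ true) e h)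
  ... | inj₁ u = parent-at (≡ᵇ-true _ _ u)
                   (subst (λ c → parents c (x + cm) ≡ x ∷ []) (sym (kind-Child (+-monoˡ-≤ cm p) (+-monoˡ-< cm q)))
                          (cong (_∷ []) (m+n∸n≡m x cm)))
  ... | inj₂ r with ∨-T (y ≡ᵇ leafOf x) _ r
  ...   | inj₁ u = parent-at (≡ᵇ-true _ _ u) (leaf-parent (support-beyond (≤-trans pend₀≤root₀ p) (≤-trans q child₀≤m)))
  child⇒parent x y h | vChild e p q with ∨-T (y ≡ᵇ leafOf x) _ (subst (λ c → elemB y (children c x) ≡ true) e h)
  ... | inj₁ u = parent-at (≡ᵇ-true _ _ u) (leaf-parent (support-beyond (≤-trans (≤-trans pend₀≤root₀ root₀≤child₀) p) q))
  child⇒parent x y h | vLeaf e p with subst (λ c → elemB y (children c x) ≡ true) e h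
  ... | ()

  parent-via : ∀ {c} x {y} → kind x ≡ c → IsParent x y → parents c x ≡ y ∷ []
  parent-via x e h = subst (λ c → parents c x ≡ _ ∷ []) e h

  leafIndex<l : ∀ {x} → m ≤ x → x < n → x ∸ m < l
  leafIndex<l {x} p x<n = <-∸ (subst (x <_) (+-comm m l) x<n) p

  leaf-support : ∀ {x} → m ≤ x → x < n → IsSupport (supportOf (x ∸ m))
  leaf-support p x<n = proj₁ (supportOf-supp (leafIndex<l p x<n))

  parent⇒child : ∀ x y → x < n → IsParent x y → IsChild y x
  parent⇒child x y x<n h with kindView x
  ... | vBig e p = child-at (sym (∷-injectiveˡ (parent-via x e h))) (spineParent-child (≤-trans p b≤s))
  ... | vPath e p q = child-at (sym (∷-injectiveˡ (parent-via x e h))) (spineParent-child q)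
  ... | vHead e _ with parent-via x e h
  ...   | ()
  parent⇒child x y x<n h | vTail e refl = child-at (sym (∷-injectiveˡ (parent-via x e h))) tail-child
  parent⇒child x y x<n h | vPend e p q with pendant-block p q
  ... | i , i<b , lo , hi = child-at (trans (sym (∷-injectiveˡ (parent-via x e h))) (pendParent-correct _ i i<b lo hi)) in-block
    where
    x≡ : pend₀ + (x ∸ pend₀) ≡ x
    x≡ = m+[n∸m]≡n p
    in-block : IsChild i x
    in-block rewrite kind-Big i<b =
      el-tl x (spineNext i) (pendantsOf i ++ (leafOf i ∷ [])) (el-++l x (pendantsOf i) (leafOf i ∷ [])
        (rng-I (pend₀ + Q i) (dd i ∸ 3) x (subst (pend₀ + Q i ≤_) x≡ (+-monoʳ-≤ pend₀ lo))
               (subst₂ _<_ x≡ (sym (+-assoc pend₀ (Q i) (dd i ∸ 3))) (+-monoʳ-< pend₀ hi))))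
  parent⇒child x y x<n h | vRoot e _ _ with parent-via x e h
  ... | ()
  parent⇒child x y x<n h | vChild e p q = child-at (sym (∷-injectiveˡ (parent-via x e h))) root-child
    where
    cm≤x : cm ≤ x
    cm≤x = ≤-trans (m≤n+m cm root₀) p
    root-child : IsChild (x ∸ cm) x
    root-child rewrite kind-Root (m+n≤o⇒m≤o∸n root₀ p) (<-∸ q cm≤x) | m∸n+n≡m cm≤x = el-hd x (leafOf (x ∸ cm) ∷ [])
  parent⇒child x y x<n h | vLeaf e p with supportOf-supp (leafIndex<l p x<n)
  ... | sp , leaf≡ = child-at (sym (∷-injectiveˡ (parent-via x e h)))
                       (subst (IsChild (supportOf (x ∸ m))) (trans leaf≡ (m+[n∸m]≡n p)) (leaf-child sp))

  parents-el : ∀ c x y → elemB y (parents c x) ≡ true → parents c x ≡ y ∷ []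
  parents-el Head x y ()
  parents-el Root x y ()
  parents-el Big x y e = cong (_∷ []) (sym (≡ᵇ-true _ _ (trans (sym (∨-identityʳ _)) e)))
  parents-el Path x y e = cong (_∷ []) (sym (≡ᵇ-true _ _ (trans (sym (∨-identityʳ _)) e)))
  parents-el Tail x y e = cong (_∷ []) (sym (≡ᵇ-true _ _ (trans (sym (∨-identityʳ _)) e)))
  parents-el Pend x y e = cong (_∷ []) (sym (≡ᵇ-true _ _ (trans (sym (∨-identityʳ _)) e)))
  parents-el Child x y e = cong (_∷ []) (sym (≡ᵇ-true _ _ (trans (sym (∨-identityʳ _)) e)))
  parents-el Leaf x y e = cong (_∷ []) (sym (≡ᵇ-true _ _ (trans (sym (∨-identityʳ _)) e)))

  adj-cases : ∀ x y → adjN x y ≡ true → IsParent x y ⊎ IsParent y x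
  adj-cases x y h with ∨-T (elemB y (parents (kind x) x)) _ (trans (sym (elemB-++ y (parents (kind x) x) (children (kind x) x))) h)
  ... | inj₁ q = inj₁ (parents-el (kind x) x y q)
  ... | inj₂ q = inj₂ (child⇒parent x y q)

  parent-adj : ∀ x y → IsParent x y → adjN x y ≡ true
  parent-adj x y p = el-++l y (parents (kind x) x) _ (subst (λ L → elemB y L ≡ true) (sym p) (el-hd y []))

  child-adj : ∀ x y → y < n → IsParent y x → adjN x y ≡ true
  child-adj x y y<n p = el-++r y (parents (kind x) x) _ (parent⇒child y x y<n p)

  adj-flip : ∀ x y → x < n → adjN x y ≡ true → adjN y x ≡ true
  adj-flip x y x<n h with adj-cases x y h
  ... | inj₁ p = child-adj y x x<n p
  ... | inj₂ p = parent-adj y x p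

  adjN-sym : ∀ x y → x < n → y < n → adjN x y ≡ adjN y x
  adjN-sym x y x<n y<n with adjN x y in e₁ | adjN y x in e₂
  ... | true | true = refl
  ... | false | false = refl
  ... | true | false = ⊥-elim (true≢false (trans (sym (adj-flip x y x<n e₁)) e₂))
  ... | false | true = ⊥-elim (true≢false (trans (sym (adj-flip y x y<n e₂)) e₁))

  -- A rank that strictly decreases from a vertex to its parent; it shows that
  -- the parent relation is well founded, so F is a forest rooted at the head
  -- and the roots of the extra components.

  rankOf : Kind → ℕ → ℕ
  rankOf Big x = suc x
  rankOf Path x = suc x
  rankOf Head x = 0
  rankOf Tail x = suc s
  rankOf Pend x = suc (suc s)
  rankOf Root x = 0
  rankOf Child x = 1
  rankOf Leaf x = suc (suc (suc s))

  rank : ℕ → ℕ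
  rank x = rankOf (kind x) x

  rank-sp : ∀ {y} → y < s → rank y ≡ suc y
  rank-sp {y} p with y <? b
  ... | yes q rewrite kind-Big q = refl
  ... | no q rewrite kind-Path (≮⇒≥ q) p = refl

  rank-supp : ∀ {y} → IsSupport y → rank y ≤ suc (suc s)
  rank-supp {y} sp with kindView y
  ... | vBig e p rewrite e = ≤-trans p (≤-trans b≤s s≤pend₀)
  ... | vPath e p q = ⊥-elim (support-not-path sp p q)
  ... | vHead e p rewrite e = z≤n
  ... | vTail e p rewrite e = n≤1+n _
  ... | vPend e p q rewrite e = ≤-refl
  ... | vRoot e p q rewrite e = z≤n
  ... | vChild e p q rewrite e = s≤s z≤n
  ... | vLeaf e p = ⊥-elim (<⇒≱ (support<m sp) p)

  rank-spPar : ∀ {x} → x < s → rank (spineParent x) < suc x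
  rank-spPar {zero} p rewrite kind-Head = s≤s z≤n
  rank-spPar {suc x} p = ≤-reflexive (cong suc (rank-sp (<-trans (n<1+n x) p)))

  rank-tail-parent : rank (pred s) < suc s
  rank-tail-parent with s ≟ 0
  ... | yes s≡0 = subst (λ w → rank w < suc s) (sym (trans (cong pred s≡0) (sym s≡0)))
                        (subst (λ c → rankOf c s < suc s) (sym kind-Head) (s≤s z≤n))
  ... | no s≢0 = ≤-reflexive (cong suc (trans (rank-sp (≤-reflexive (suc-pred′ s s≢0))) (suc-pred′ s s≢0)))

  rank-lt : ∀ x y → x < n → IsParent x y → rank y < rank x
  rank-lt x y x<n h with kindView x
  ... | vBig e p rewrite e | sym (∷-injectiveˡ h) = rank-spPar (≤-trans p b≤s)
  ... | vPath e p q rewrite e | sym (∷-injectiveˡ h) = rank-spPar q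
  ... | vHead e _ with parent-via x e h
  ...   | ()
  rank-lt x y x<n h | vTail e refl rewrite e | sym (∷-injectiveˡ h) = rank-tail-parent
  rank-lt x y x<n h | vPend e p q with pendant-block p q
  ... | i , i<b , lo , hi rewrite e | sym (∷-injectiveˡ h) | pendParent-correct _ i i<b lo hi | kind-Big i<b =
    s≤s (≤-trans i<b (≤-trans b≤s (n≤1+n s)))
  rank-lt x y x<n h | vRoot e _ _ with parent-via x e h
  ... | ()
  rank-lt x y x<n h | vChild e p q rewrite e | sym (∷-injectiveˡ h)
                                          | kind-Root (m+n≤o⇒m≤o∸n root₀ p) (<-∸ q (≤-trans (m≤n+m cm root₀) p)) = s≤s z≤n
  rank-lt x y x<n h | vLeaf e p rewrite e | sym (∷-injectiveˡ h) = s≤s (rank-supp (leaf-support p x<n))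

  adjN-irrefl : ∀ x → x < n → adjN x x ≡ false
  adjN-irrefl x x<n = ¬-not λ e → <-irrefl refl (self-parent (adj-cases x x e))
    where
    self-parent : IsParent x x ⊎ IsParent x x → rank x < rank x
    self-parent (inj₁ p) = rank-lt x x x<n p
    self-parent (inj₂ p) = rank-lt x x x<n p

  record Profile : Set where
    field
      deg-big : ∀ x → x < b → 3 ≤ dd x
      deg-two : ∀ x → b ≤ x → x < m → dd x ≡ 2
      deg-one : ∀ x → m ≤ x → x < n → dd x ≡ 1

  m<n : ∀ {y} → y < m → y < n
  m<n p = ≤-trans p m≤n

  spineParent≤s : ∀ {x} → x < s → spineParent x ≤ s
  spineParent≤s {zero} p = ≤-refl
  spineParent≤s {suc x} p = <⇒≤ (<-trans (n<1+n x) p)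

  spineNext≤1+s : ∀ x → spineNext x ≤ suc s
  spineNext≤1+s x with suc x <? s
  ... | yes q rewrite spineNext-inside q = ≤-trans (<⇒≤ q) (n≤1+n s)
  ... | no q rewrite spineNext-end (≮⇒≥ q) = ≤-refl

  spineFirst≤1+s : spineFirst ≤ suc s
  spineFirst≤1+s with 0 <? s
  ... | yes q rewrite spineFirst-0 q = z≤n
  ... | no q rewrite spineFirst-tail (n≤0⇒n≡0 (≮⇒≥ q)) = ≤-refl

  spineParent<m : ∀ {x} → x < s → spineParent x < m
  spineParent<m p = ≤-<-trans (spineParent≤s p) s<m

  spineNext<m : ∀ x → spineNext x < m
  spineNext<m x = ≤-<-trans (spineNext≤1+s x) 1+s<m

  spineParent≢spineNext : ∀ {x} → x < s → spineParent x ≢ spineNext x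
  spineParent≢spineNext {zero} p eq with 1 <? s
  ... | yes q = <-irrefl (sym (trans eq (spineNext-inside q))) q
  ... | no q = <-irrefl (trans eq (spineNext-end (≮⇒≥ q))) ≤-refl
  spineParent≢spineNext {suc x} p eq with suc (suc x) <? s
  ... | yes q = <-irrefl (trans eq (spineNext-inside q)) (≤-trans (n<1+n x) (n≤1+n (suc x)))
  ... | no q = <⇒≱ (<-trans (n<1+n x) p) (subst (s ≤_) (sym (trans eq (spineNext-end (≮⇒≥ q)))) (n≤1+n s))

  isSupportN : ℕ → Bool
  isSupportN x = (x <ᵇ b) ∨ ((s ≤ᵇ x) ∧ (x <ᵇ m))

  isSupportN-big : ∀ {x} → x < b → isSupportN x ≡ true
  isSupportN-big {x} p rewrite <ᵇ-true x b p = refl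

  isSupportN-inner : ∀ {x} → s ≤ x → x < m → isSupportN x ≡ true
  isSupportN-inner {x} p q rewrite <ᵇ-false x b (≤-trans b≤s p) | ≤ᵇ-true s x p | <ᵇ-true x m q = refl

  isSupportN-supp : ∀ {x} → IsSupport x → isSupportN x ≡ true
  isSupportN-supp (inj₁ p) = isSupportN-big p
  isSupportN-supp (inj₂ (p , q)) = isSupportN-inner p q

  isSupportN-path : ∀ {x} → b ≤ x → x < s → isSupportN x ≡ false
  isSupportN-path {x} p q rewrite <ᵇ-false x b p | ≤ᵇ-false s x q = refl

  isSupportN-leaf : ∀ {x} → m ≤ x → isSupportN x ≡ false
  isSupportN-leaf {x} p rewrite <ᵇ-false x b (≤-trans (≤-trans b≤s (<⇒≤ s<m)) p) | <ᵇ-false x m p =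
    ∧-zeroʳ (s ≤ᵇ x)

  support-countN : cnt isSupportN n ≡ l
  support-countN = begin
    cnt isSupportN n                                                ≡⟨ cong (cnt isSupportN) layout ⟩
    cnt isSupportN (b + (k + (a + l)))                              ≡⟨ cnt-split b (k + (a + l)) isSupportN ⟩
    cnt isSupportN b + cnt (λ x → isSupportN (b + x)) (k + (a + l)) ≡⟨ cong₂ _+_ bigs (cnt-split k (a + l) (λ x → isSupportN (b + x))) ⟩
    b + (cnt (λ x → isSupportN (b + x)) k + cnt (λ x → isSupportN (b + (k + x))) (a + l))
                                                                    ≡⟨ cong (λ z → b + (z + cnt (λ x → isSupportN (b + (k + x))) (a + l))) paths ⟩
    b + cnt (λ x → isSupportN (b + (k + x))) (a + l)                ≡⟨ cong (b +_) (cnt-split a l (λ x → isSupportN (b + (k + x)))) ⟩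
    b + (cnt (λ x → isSupportN (b + (k + x))) a + cnt (λ x → isSupportN (b + (k + (a + x)))) l)
                                                                    ≡⟨ cong (b +_) (cong₂ _+_ inners leaves) ⟩
    b + (a + 0)                                                     ≡⟨ cong (b +_) (+-identityʳ a) ⟩
    l ∎
    where
    open ≡-Reasoning
    layout : n ≡ b + (k + (a + l))
    layout = trans (cong (_+ l) m≡s+a) (trans (+-assoc s a l) (+-assoc b k (a + l)))
    bigs : cnt isSupportN b ≡ b
    bigs = cnt-true b _ (λ x → isSupportN-big)
    paths : cnt (λ x → isSupportN (b + x)) k ≡ 0
    paths = cnt-false k _ (λ x p → isSupportN-path (m≤m+n b x) (+-monoʳ-< b p))
    inners : cnt (λ x → isSupportN (b + (k + x))) a ≡ a
    inners = cnt-true a _ (λ x p → isSupportN-inner (subst (s ≤_) (+-assoc b k x) (m≤m+n s x))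
                                                    (subst₂ _<_ (+-assoc b k x) (sym m≡s+a) (+-monoʳ-< s p)))
    leaves : cnt (λ x → isSupportN (b + (k + (a + x)))) l ≡ 0
    leaves = cnt-false l _ (λ x p → isSupportN-leaf (subst₂ _≤_ (sym m≡s+a) (trans (+-assoc s a x) (+-assoc b k (a + x))) (m≤m+n (s + a) x)))

  record NbrData (L : List ℕ) (dx : ℕ) (sp : Bool) : Set where
    field
      nbD : Dist L
      nbB : Bnd n L
      nbDeg : cntL (λ _ → true) L ≡ dx
      nbLf : cntL (λ y → m ≤ᵇ y) L ≡ b2n sp

  two-leaf : ∀ u y → u < m → IsSupport y → NbrData (u ∷ leafOf y ∷ []) 2 true
  two-leaf u y u<m sy = record
    { nbD = dist2 (<⇒≢ (≤-trans u<m (m≤leafOf y)))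
    ; nbB = m<n u<m , leafOf<n sy , tt
    ; nbDeg = refl
    ; nbLf = cong₂ (λ p q → b2n p + (b2n q + 0)) (≤ᵇ-false m u u<m) (≤ᵇ-true m _ (m≤leafOf y)) }

  module BigChildren (x : ℕ) (x<b : x < b) where
    pendants offSpine : List ℕ
    pendants = pendantsOf x
    offSpine = pendants ++ (leafOf x ∷ [])

    pendant-range : ∀ z → elemB z pendants ≡ true → pend₀ ≤ z × z < m
    pendant-range z e with rng-T _ _ z e
    ... | p , q = ≤-trans (m≤m+n pend₀ (Q x)) p
                , <-≤-trans (subst (z <_) (+-assoc pend₀ (Q x) _) q)
                            (≤-trans (+-monoʳ-≤ pend₀ (surplus-mono x<b)) (≤-trans root₀≤child₀ child₀≤m))

    offSpine-range : ∀ z → elemB z offSpine ≡ true → pend₀ ≤ z × z < n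
    offSpine-range z e with ∨-T (elemB z pendants) _ (trans (sym (elemB-++ z pendants _)) e)
    ... | inj₁ r = proj₁ (pendant-range z r) , m<n (proj₂ (pendant-range z r))
    ... | inj₂ r with ∨-T (z ≡ᵇ leafOf x) false r
    ...   | inj₁ u = subst (λ w → pend₀ ≤ w × w < n) (sym (≡ᵇ-true _ _ u))
                       (≤-trans pend₀≤m (m≤leafOf x) , leafOf<n (inj₁ x<b))

    offSpine-dist : Dist offSpine
    offSpine-dist = Dist-++ pendants _ (rng-Dist _ _) (refl , tt)
      (λ z e → trans (∨-identityʳ _) (≡ᵇ-false z _ (<⇒≢ (≤-trans (proj₂ (pendant-range z e)) (m≤leafOf x)))))

    offSpine-length : cntL (λ _ → true) offSpine ≡ (dd x ∸ 3) + 1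
    offSpine-length = trans (cntL-++ _ pendants _) (cong (_+ 1) (cntL-rng-true _ _ _ (λ _ _ _ → refl)))

    offSpine-leaves : cntL (λ z → m ≤ᵇ z) offSpine ≡ 1
    offSpine-leaves = trans (cntL-++ _ pendants _)
      (cong₂ _+_ (cntL-rng-false _ (pend₀ + Q x) (dd x ∸ 3)
                    (λ z p q → ≤ᵇ-false m z (proj₂ (pendant-range z (rng-I (pend₀ + Q x) (dd x ∸ 3) z p q)))))
                 (cong (λ w → b2n w + 0) (≤ᵇ-true m _ (m≤leafOf x))))

    big-nbrData : 3 ≤ dd x → NbrData (spineParent x ∷ spineNext x ∷ offSpine) (dd x) true
    big-nbrData 3≤dx = record
      { nbD = elemB-none (spineParent x) (spineNext x ∷ offSpine) parent-fresh
            , elemB-none (spineNext x) offSpine (λ z ez → <⇒≢ (<-≤-trans (s≤s (spineNext≤1+s x)) (proj₁ (offSpine-range z ez))))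
            , offSpine-dist
      ; nbB = m<n (spineParent<m x<s) , m<n (spineNext<m x) , bnd-of n offSpine (λ z e → proj₂ (offSpine-range z e))
      ; nbDeg = trans (cong (λ w → suc (suc w)) offSpine-length) (trans (+3 (dd x ∸ 3)) (m∸n+n≡m 3≤dx))
      ; nbLf = trans (cong₂ (λ u v → b2n u + (b2n v + cntL (λ z → m ≤ᵇ z) offSpine))
                            (≤ᵇ-false m _ (spineParent<m x<s)) (≤ᵇ-false m _ (spineNext<m x)))
                     offSpine-leaves }
      where
      x<s : x < s
      x<s = ≤-trans x<b b≤s
      +3 : ∀ u → suc (suc (u + 1)) ≡ u + 3
      +3 = solve-∀
      parent-fresh : ∀ z → elemB z (spineNext x ∷ offSpine) ≡ true → spineParent x ≢ z
      parent-fresh z ez with ∨-T (z ≡ᵇ spineNext x) _ ez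
      ... | inj₁ u = subst (spineParent x ≢_) (sym (≡ᵇ-true _ _ u)) (spineParent≢spineNext x<s)
      ... | inj₂ u = <⇒≢ (<-≤-trans (s≤s (m≤n⇒m≤1+n (spineParent≤s x<s))) (proj₁ (offSpine-range z u)))

  module _ (prof : Profile) where
    open Profile prof

    inner-nbrData : ∀ u y → u < m → s ≤ y → y < m → NbrData (u ∷ leafOf y ∷ []) (dd y) (isSupportN y)
    inner-nbrData u y u<m s≤y y<m rewrite isSupportN-inner s≤y y<m | deg-two y (≤-trans b≤s s≤y) y<m =
      two-leaf u y u<m (inj₂ (s≤y , y<m))

    nbrData : ∀ x → x < n → NbrData (nbrs x) (dd x) (isSupportN x)
    nbrData x x<n with kindView x
    ... | vBig e p rewrite e | isSupportN-big p = BigChildren.big-nbrData x p (deg-big x p)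
    ... | vPath e p q rewrite e | isSupportN-path p q | deg-two x p (<-trans q s<m) = record
      { nbD = dist2 (spineParent≢spineNext q)
      ; nbB = m<n (spineParent<m q) , m<n (spineNext<m x) , tt
      ; nbDeg = refl
      ; nbLf = cong₂ (λ u v → b2n u + (b2n v + 0)) (≤ᵇ-false m _ (spineParent<m q)) (≤ᵇ-false m _ (spineNext<m x)) }
    ... | vHead e refl rewrite e = inner-nbrData spineFirst s (≤-<-trans spineFirst≤1+s 1+s<m) ≤-refl s<m
    ... | vTail e refl rewrite e = inner-nbrData (pred s) (suc s) (≤-<-trans (pred[n]≤n {s}) s<m) (n≤1+n s) 1+s<m
    ... | vPend e p q rewrite e =
      inner-nbrData (pendParent (x ∸ pend₀)) x (≤-trans (pendParent<b p q) (≤-trans b≤s (<⇒≤ s<m)))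
                    (≤-trans s≤pend₀ p) (<-≤-trans q (≤-trans root₀≤child₀ child₀≤m))
    ... | vRoot e p q rewrite e =
      inner-nbrData (x + cm) x (+-monoˡ-< cm q) (≤-trans (≤-trans s≤pend₀ pend₀≤root₀) p) (<-≤-trans q child₀≤m)
    ... | vChild e p q rewrite e =
      inner-nbrData (x ∸ cm) x (≤-<-trans (m∸n≤m x cm) q) (≤-trans (≤-trans s≤pend₀ (≤-trans pend₀≤root₀ root₀≤child₀)) p) q
    ... | vLeaf e p rewrite e | isSupportN-leaf p | deg-one x p x<n = record
      { nbD = refl , tt
      ; nbB = m<n (support<m (leaf-support p x<n)) , tt
      ; nbDeg = refl
      ; nbLf = cong (λ u → b2n u + 0) (≤ᵇ-false m _ (support<m (leaf-support p x<n))) }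

  -- Components.  comp x labels the component of x: 0 for the tree containing
  -- the spine, r + 1 for the r-th extra component.  Labels are constant along
  -- parent edges, and every vertex reaches the root of its label.

  compInner : Kind → ℕ → ℕ
  compInner Root x = suc (x ∸ root₀)
  compInner Child x = suc (x ∸ child₀)
  compInner _ x = 0

  compOf : Kind → ℕ → ℕ
  compOf Leaf x = compInner (kind (supportOf (x ∸ m))) (supportOf (x ∸ m))
  compOf c x = compInner c x

  comp : ℕ → ℕ
  comp x = compOf (kind x) x

  comp-inner : ∀ {y} → y < m → comp y ≡ compInner (kind y) y
  comp-inner {y} p with kindView y
  ... | vBig e _ rewrite e = refl
  ... | vPath e _ _ rewrite e = refl
  ... | vHead e _ rewrite e = refl
  ... | vTail e _ rewrite e = refl
  ... | vPend e _ _ rewrite e = refl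
  ... | vRoot e _ _ rewrite e = refl
  ... | vChild e _ _ rewrite e = refl
  ... | vLeaf e q = ⊥-elim (<⇒≱ p q)

  comp-spine : ∀ {y} → y ≤ s → comp y ≡ 0
  comp-spine {y} p with m≤n⇒m<n∨m≡n p
  ... | inj₂ refl rewrite kind-Head = refl
  ... | inj₁ q with y <? b
  ...   | yes r rewrite kind-Big r = refl
  ...   | no r rewrite kind-Path (≮⇒≥ r) q = refl

  comp-parent : ∀ x y → x < n → IsParent x y → comp x ≡ comp y
  comp-parent x y x<n h with kindView x
  ... | vBig e p rewrite e | sym (∷-injectiveˡ h) = sym (comp-spine (spineParent≤s (≤-trans p b≤s)))
  ... | vPath e p q rewrite e | sym (∷-injectiveˡ h) = sym (comp-spine (spineParent≤s q))
  ... | vHead e _ with parent-via x e h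
  ...   | ()
  comp-parent x y x<n h | vTail e refl rewrite e | sym (∷-injectiveˡ h) = sym (comp-spine (pred[n]≤n {s}))
  comp-parent x y x<n h | vPend e p q rewrite e | sym (∷-injectiveˡ h) = sym (comp-spine (≤-trans (<⇒≤ (pendParent<b p q)) b≤s))
  comp-parent x y x<n h | vRoot e _ _ with parent-via x e h
  ... | ()
  comp-parent x y x<n h | vChild e p q rewrite e | sym (∷-injectiveˡ h) | comp-inner {x ∸ cm} (≤-<-trans (m∸n≤m x cm) q)
                                           | kind-Root (m+n≤o⇒m≤o∸n root₀ p) (<-∸ q (≤-trans (m≤n+m cm root₀) p)) =
    cong suc (trans (cong (x ∸_) (+-comm root₀ cm)) (sym (∸-+-assoc x cm root₀)))
  comp-parent x y x<n h | vLeaf e p rewrite e | sym (∷-injectiveˡ h) = sym (comp-inner (support<m (leaf-support p x<n)))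

  compInner<c : ∀ {y} → y < m → compInner (kind y) y < suc cm
  compInner<c {y} p with kindView y
  ... | vBig e _ rewrite e = s≤s z≤n
  ... | vPath e _ _ rewrite e = s≤s z≤n
  ... | vHead e _ rewrite e = s≤s z≤n
  ... | vTail e _ rewrite e = s≤s z≤n
  ... | vPend e _ _ rewrite e = s≤s z≤n
  ... | vRoot e q r rewrite e = s≤s (<-∸ (subst (y <_) (+-comm root₀ cm) r) q)
  ... | vChild e q r rewrite e = s≤s (<-∸ (subst (y <_) (+-comm child₀ cm) r) q)
  ... | vLeaf e q = ⊥-elim (<⇒≱ p q)

  comp<c : ∀ {y} → y < n → comp y < suc cm
  comp<c {y} y<n with y <? m
  ... | yes p = subst (_< suc cm) (sym (comp-inner p)) (compInner<c p)
  ... | no p rewrite kind-Leaf (≮⇒≥ p) = compInner<c (support<m (leaf-support (≮⇒≥ p) y<n))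

  root : ℕ → ℕ
  root zero = s
  root (suc r) = root₀ + r

  root<m : ∀ r → r < suc cm → root r < m
  root<m zero _ = s<m
  root<m (suc r) (s≤s p) = <-≤-trans (+-monoʳ-< root₀ p) child₀≤m

  root-comp : ∀ r → r < suc cm → comp (root r) ≡ r
  root-comp zero _ rewrite kind-Head = refl
  root-comp (suc r) (s≤s p) rewrite kind-Root (m≤m+n root₀ r) (+-monoʳ-< root₀ p) = cong suc (m+n∸m≡n root₀ r)

  parentless-root : ∀ x → x < n → parents (kind x) x ≡ [] → x ≡ root (comp x)
  parentless-root x x<n h with kindView x
  ... | vHead e refl rewrite e = refl
  ... | vRoot e p q rewrite e = sym (m+[n∸m]≡n p)
  ... | vBig e _ rewrite e with h
  ...   | ()
  parentless-root x x<n h | vPath e _ _ rewrite e with h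
  ... | ()
  parentless-root x x<n h | vTail e _ rewrite e with h
  ... | ()
  parentless-root x x<n h | vPend e _ _ rewrite e with h
  ... | ()
  parentless-root x x<n h | vChild e _ _ rewrite e with h
  ... | ()
  parentless-root x x<n h | vLeaf e _ rewrite e with h
  ... | ()

  parent<m : ∀ x y → x < n → IsParent x y → y < m
  parent<m x y x<n h with kindView x
  ... | vBig e p rewrite e | sym (∷-injectiveˡ h) = spineParent<m (≤-trans p b≤s)
  ... | vPath e p q rewrite e | sym (∷-injectiveˡ h) = spineParent<m q
  ... | vHead e _ with parent-via x e h
  ...   | ()
  parent<m x y x<n h | vTail e refl rewrite e | sym (∷-injectiveˡ h) = ≤-<-trans (pred[n]≤n {s}) s<m
  parent<m x y x<n h | vPend e p q rewrite e | sym (∷-injectiveˡ h) = ≤-trans (pendParent<b p q) (≤-trans b≤s (<⇒≤ s<m))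
  parent<m x y x<n h | vRoot e _ _ with parent-via x e h
  ... | ()
  parent<m x y x<n h | vChild e p q rewrite e | sym (∷-injectiveˡ h) = ≤-<-trans (m∸n≤m x cm) q
  parent<m x y x<n h | vLeaf e p rewrite e | sym (∷-injectiveˡ h) = support<m (leaf-support p x<n)

  parents-shape : ∀ c x → parents c x ≡ [] ⊎ ∃ λ y → parents c x ≡ y ∷ []
  parents-shape Head x = inj₁ refl
  parents-shape Root x = inj₁ refl
  parents-shape Big x = inj₂ (_ , refl)
  parents-shape Path x = inj₂ (_ , refl)
  parents-shape Tail x = inj₂ (_ , refl)
  parents-shape Pend x = inj₂ (_ , refl)
  parents-shape Child x = inj₂ (_ , refl)
  parents-shape Leaf x = inj₂ (_ , refl)

  spine-parent-suc : ∀ {x y} → x < s → y < s → IsParent x y → x ≡ suc y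
  spine-parent-suc {zero} {y} p q h = ⊥-elim (<-irrefl (sym (∷-injectiveˡ (trans (sym (spine-parent p)) h))) q)
  spine-parent-suc {suc x} {y} p q h = cong suc (∷-injectiveˡ (trans (sym (spine-parent p)) h))

  spine-adj : ∀ {x y} → x < s → y < s → adjN x y ≡ true → x ≡ suc y ⊎ y ≡ suc x
  spine-adj {x} {y} p q h with adj-cases x y h
  ... | inj₁ r = inj₁ (spine-parent-suc p q r)
  ... | inj₂ r = inj₂ (spine-parent-suc q p r)

  spine-consecutive-adj : ∀ {y} → suc y < s → adjN (suc y) y ≡ true × adjN y (suc y) ≡ true
  spine-consecutive-adj {y} p = parent-adj (suc y) y (spine-parent p) , child-adj y (suc y) (m<n (<-trans p s<m)) (spine-parent p)

  path-nbr : ∀ {x u} → b ≤ x → x < s → u < n → adjN x u ≡ true → u ≡ spineParent x ⊎ u ≡ spineNext x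
  path-nbr {x} {u} b≤x x<s u<n h with adj-cases x u h
  ... | inj₁ x→u = inj₁ (sym (∷-injectiveˡ (trans (sym (spine-parent x<s)) x→u)))
  ... | inj₂ u→x with ∨-T (u ≡ᵇ spineNext x) false
                        (subst (λ c → elemB u (children c x) ≡ true) (kind-Path b≤x x<s) (parent⇒child u x u<n u→x))
  ...   | inj₁ e = inj₂ (≡ᵇ-true _ _ e)

-- Vertices are
-- grouped into blocks: the l support–leaf pairs, and runs of consecutive path
-- vertices.  blockOf dv sends a vertex to its block; dv = d3 groups the path
-- into triples, dv = d2 into pairs.
module Extremal (b k cm : ℕ) (dd : ℕ → ℕ) where

  open Construction b k cm dd

  -- the block of x: pair blocks are numbered 0, …, l − 1, path blocks from l on
  blockOf : (ℕ → ℕ) → ℕ → ℕ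
  blockOf dv x = if x <ᵇ b then x else if x <ᵇ s then l + dv (x ∸ b) else if x <ᵇ m then x ∸ k else x ∸ m

  blockOf-big : ∀ dv {x} → x < b → blockOf dv x ≡ x
  blockOf-big dv {x} p rewrite <ᵇ-true x b p = refl

  blockOf-path : ∀ dv {x} → b ≤ x → x < s → blockOf dv x ≡ l + dv (x ∸ b)
  blockOf-path dv {x} p q rewrite <ᵇ-false x b p | <ᵇ-true x s q = refl

  blockOf-inner : ∀ dv {x} → s ≤ x → x < m → blockOf dv x ≡ x ∸ k
  blockOf-inner dv {x} p q rewrite <ᵇ-false x b (≤-trans b≤s p) | <ᵇ-false x s p | <ᵇ-true x m q = refl

  blockOf-leaf : ∀ dv {x} → m ≤ x → blockOf dv x ≡ x ∸ m
  blockOf-leaf dv {x} p rewrite <ᵇ-false x b (≤-trans (≤-trans b≤s (<⇒≤ s<m)) p)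
                              | <ᵇ-false x s (≤-trans (<⇒≤ s<m) p) | <ᵇ-false x m p = refl

  path<n : ∀ {t} → t < k → b + t < n
  path<n p = m<n (<-trans (+-monoʳ-< b p) s<m)

  blockOf-pathAt : ∀ dv {t} → t < k → blockOf dv (b + t) ≡ l + dv t
  blockOf-pathAt dv {t} p = trans (blockOf-path dv (m≤m+n b t) (+-monoʳ-< b p)) (cong (λ w → l + dv w) (m+n∸m≡n b t))

  blockOf-supportOf : ∀ dv {t} → t < l → blockOf dv (supportOf t) ≡ t
  blockOf-supportOf dv {t} p with t <? b
  ... | yes t<b rewrite supportOf-big t<b = blockOf-big dv t<b
  ... | no t≮b rewrite supportOf-other (≮⇒≥ t≮b) =
    trans (blockOf-inner dv (+-monoˡ-≤ k (≮⇒≥ t≮b)) (subst (t + k <_) l+k≡m (+-monoˡ-< k p))) (m+n∸n≡m t k)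

  blockOf-supp : ∀ dv {y} → IsSupport y → supportOf (blockOf dv y) ≡ y × blockOf dv y < l
  blockOf-supp dv (inj₁ p) rewrite blockOf-big dv p = supportOf-big p , ≤-trans p (m≤m+n b a)
  blockOf-supp dv {y} (inj₂ (p , q)) rewrite blockOf-inner dv p q =
    trans (supportOf-other (s≤⇒b≤∸k p)) (m∸n+n≡m (s≤⇒k≤ p)) , subst (y ∸ k <_) m-k≡l (∸-monoˡ-< q (s≤⇒k≤ p))

  data VertexClass (x : ℕ) : Set where
    supportV : IsSupport x → VertexClass x
    pathV : b ≤ x → x < s → VertexClass x
    leafV : m ≤ x → VertexClass x

  classify : ∀ x → VertexClass x
  classify x with x <? b
  ... | yes p = supportV (inj₁ p)
  ... | no p with x <? s
  ...   | yes q = pathV (≮⇒≥ p) q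
  ...   | no q with x <? m
  ...     | yes r = supportV (inj₂ (≮⇒≥ q , r))
  ...     | no r = leafV (≮⇒≥ r)

  path-offset : ∀ {x} → b ≤ x → x < s → x ∸ b < k
  path-offset {x} p q = <-∸ (subst (x <_) (+-comm b k) q) p

  pair-block<l : ∀ dv {x} → x < n → IsSupport x ⊎ m ≤ x → blockOf dv x < l
  pair-block<l dv x<n (inj₁ sp) = proj₂ (blockOf-supp dv sp)
  pair-block<l dv x<n (inj₂ p) rewrite blockOf-leaf dv p = leafIndex<l p x<n

  pair≢path : ∀ dv {x y} → x < n → IsSupport x ⊎ m ≤ x → b ≤ y → y < s → blockOf dv x ≢ blockOf dv y
  pair≢path dv x<n cx p q e =
    <⇒≱ (pair-block<l dv x<n cx) (subst (l ≤_) (sym (trans e (blockOf-path dv p q))) (m≤m+n l _))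

  pair-parent : ∀ dv {x y} → IsSupport x → m ≤ y → blockOf dv x ≡ blockOf dv y → IsParent y x
  pair-parent dv {x} {y} sx p e =
    subst (IsParent y) (trans (cong supportOf (trans (sym (blockOf-leaf dv p)) (sym e))) (proj₁ (blockOf-supp dv sx)))
          (parents-Leaf p)

  leaf-block-inj : ∀ dv {x y} → m ≤ x → m ≤ y → blockOf dv x ≡ blockOf dv y → x ≡ y
  leaf-block-inj dv {x} {y} p q e =
    trans (sym (m+[n∸m]≡n p)) (trans (cong (m +_) (trans (sym (blockOf-leaf dv p)) (trans e (blockOf-leaf dv q)))) (m+[n∸m]≡n q))

  supp-block-inj : ∀ dv {x y} → IsSupport x → IsSupport y → blockOf dv x ≡ blockOf dv y → x ≡ y
  supp-block-inj dv sx sy e = trans (sym (proj₁ (blockOf-supp dv sx))) (trans (cong supportOf e) (proj₁ (blockOf-supp dv sy)))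

  path-block-eq : ∀ dv {x y} → b ≤ x → x < s → b ≤ y → y < s → blockOf dv x ≡ blockOf dv y → dv (x ∸ b) ≡ dv (y ∸ b)
  path-block-eq dv p q p′ q′ e = +-cancelˡ-≡ l _ _ (trans (sym (blockOf-path dv p q)) (trans e (blockOf-path dv p′ q′)))

  path-offset-inj : ∀ {x y} → b ≤ x → b ≤ y → x ∸ b ≡ y ∸ b → x ≡ y
  path-offset-inj {x} {y} p q e = trans (sym (m+[n∸m]≡n p)) (trans (cong (b +_) e) (m+[n∸m]≡n q))

  Dominates : (ℕ → Bool) → Set
  Dominates P = ∀ x → x < n → P x ≡ false → ∃ λ u → u < n × P u ≡ true × adjN x u ≡ true

  covered : ∀ P → Dominates P → ∀ x → x < n → ∃ λ u → u < n × P u ≡ true × (u ≡ x ⊎ adjN x u ≡ true)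
  covered P dom x x<n with P x in e
  ... | true = x , x<n , e , inj₁ refl
  ... | false with dom x x<n e
  ...   | u , u<n , pu , adj = u , u<n , pu , inj₂ adj

  -- a dominating set meets every pair block β: in the leaf m + β or its support
  pair-block-hit : ∀ P → Dominates P → ∀ β → β < l → ∃ λ u → u < n × P u ≡ true × blockOf d3 u ≡ β
  pair-block-hit P dom β β<l = hit (covered P dom (m + β) (+-monoʳ-< m β<l))
    where
    leaf≥m : m ≤ m + β
    leaf≥m = m≤m+n m β
    leaf→support : IsParent (m + β) (supportOf β)
    leaf→support = subst (λ w → IsParent (m + β) (supportOf w)) (m+n∸m≡n m β) (parents-Leaf leaf≥m)
    hit : (∃ λ u → u < n × P u ≡ true × (u ≡ m + β ⊎ adjN (m + β) u ≡ true))
        → ∃ λ u → u < n × P u ≡ true × blockOf d3 u ≡ β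
    hit (u , u<n , pu , inj₁ refl) = u , u<n , pu , trans (blockOf-leaf d3 leaf≥m) (m+n∸m≡n m β)
    hit (u , u<n , pu , inj₂ adj) with adj-cases (m + β) u adj
    ... | inj₂ u→leaf = ⊥-elim (<⇒≱ (parent<m u (m + β) u<n u→leaf) leaf≥m)
    ... | inj₁ leaf→u = u , u<n , pu ,
            subst (λ w → blockOf d3 w ≡ β) (∷-injectiveˡ (trans (sym leaf→support) leaf→u)) (blockOf-supportOf d3 β<l)

  -- a dominating set meets every path triple q: in the middle vertex
  -- b + 3q + 1 or one of its spine neighbours b + 3q, b + 3q + 2
  path-block-hit : ∀ P → Dominates P → ∀ q → q < d3 k → ∃ λ u → u < n × P u ≡ true × blockOf d3 u ≡ l + q
  path-block-hit P dom q q<k/3 = hit (covered P dom x₁ (path<n (offset<k 1 (s≤s (s≤s z≤n)))))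
    where
    3q+3≤k : 3 * q + 3 ≤ k
    3q+3≤k = d3-lt q k q<k/3
    offset<k : ∀ r → r < 3 → 3 * q + r < k
    offset<k r r<3 = <-≤-trans (+-monoʳ-< (3 * q) r<3) 3q+3≤k
    x₁ : ℕ
    x₁ = b + (3 * q + 1)
    in-triple : ∀ r → r < 3 → blockOf d3 (b + (3 * q + r)) ≡ l + q
    in-triple r r<3 = trans (blockOf-pathAt d3 (offset<k r r<3)) (cong (l +_) (proj₁ (d3-eq q r r<3)))
    x₁≡ : x₁ ≡ suc (b + (3 * q + 0))
    x₁≡ = trans (cong (b +_) (+-suc (3 * q) 0)) (+-suc b (3 * q + 0))
    x₂≡ : suc x₁ ≡ b + (3 * q + 2)
    x₂≡ = trans (sym (+-suc b (3 * q + 1))) (cong (b +_) (sym (+-suc (3 * q) 1)))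
    next≡ : spineNext x₁ ≡ b + (3 * q + 2)
    next≡ = trans (spineNext-inside (subst (_< s) (sym x₂≡) (+-monoʳ-< b (offset<k 2 ≤-refl)))) x₂≡
    hit : (∃ λ u → u < n × P u ≡ true × (u ≡ x₁ ⊎ adjN x₁ u ≡ true))
        → ∃ λ u → u < n × P u ≡ true × blockOf d3 u ≡ l + q
    hit (u , u<n , pu , inj₁ refl) = u , u<n , pu , in-triple 1 (s≤s (s≤s z≤n))
    hit (u , u<n , pu , inj₂ adj) with path-nbr (m≤m+n b _) (+-monoʳ-< b (offset<k 1 (s≤s (s≤s z≤n)))) u<n adj
    ... | inj₁ u≡parent = u , u<n , pu , subst (λ w → blockOf d3 w ≡ l + q) (sym (trans u≡parent (cong spineParent x₁≡))) (in-triple 0 z<s)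
    ... | inj₂ u≡next = u , u<n , pu , subst (λ w → blockOf d3 w ≡ l + q) (sym (trans u≡next next≡)) (in-triple 2 ≤-refl)

  domination-lower : ∀ P → Dominates P → l + d3 k ≤ cnt P n
  domination-lower P dom = labels-onto⇒≤ n P (blockOf d3) (l + d3 k) hit
    where
    hit : ∀ β → β < l + d3 k → ∃ λ x → x < n × P x ≡ true × blockOf d3 x ≡ β
    hit β β<B with β <? l
    ... | yes β<l = pair-block-hit P dom β β<l
    ... | no β≮l with path-block-hit P dom (β ∸ l) (+-cancelˡ-< l _ _ (subst (_< l + d3 k) (sym β≡) β<B))
      where
      β≡ : l + (β ∸ l) ≡ β
      β≡ = m+[n∸m]≡n (≮⇒≥ β≮l)
    ...   | x , x<n , px , bx = x , x<n , px , trans bx (m+[n∸m]≡n (≮⇒≥ β≮l))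

  -- The minimum dominating set: all supports, and every third path vertex
  -- (those b + t with t ≡ 2 mod 3).

  domSet : ℕ → Bool
  domSet x = isSupportN x ∨ ((b ≤ᵇ x) ∧ ((x <ᵇ s) ∧ (m3 (x ∸ b) ≡ᵇ 2)))

  domSet-path : ∀ {x} → b ≤ x → x < s → domSet x ≡ (m3 (x ∸ b) ≡ᵇ 2)
  domSet-path {x} p q rewrite isSupportN-path p q | ≤ᵇ-true b x p | <ᵇ-true x s q = refl

  domSet-leaf : ∀ {x} → m ≤ x → domSet x ≡ false
  domSet-leaf {x} p rewrite isSupportN-leaf p | <ᵇ-false x s (≤-trans (<⇒≤ s<m) p) = ∧-zeroʳ (b ≤ᵇ x)

  domSet-supp : ∀ {x} → IsSupport x → domSet x ≡ true
  domSet-supp sp rewrite isSupportN-supp sp = refl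

  domSet-pathAt : ∀ {t} → t < k → domSet (b + t) ≡ (m3 t ≡ᵇ 2)
  domSet-pathAt {t} p = trans (domSet-path (m≤m+n b t) (+-monoʳ-< b p)) (cong (λ w → m3 w ≡ᵇ 2) (m+n∸m≡n b t))

  path-dominated : ∀ {x} → b ≤ x → x < s → domSet x ≡ false → ∃ λ u → u < n × domSet u ≡ true × adjN x u ≡ true
  path-dominated {x} p q e with m3-cases (x ∸ b)
  ... | inj₂ (inj₂ r) = ⊥-elim (true≢false (trans (sym (trans (domSet-path p q) (cong (_≡ᵇ 2) r))) e))
  ... | inj₂ (inj₁ r) with suc x <? s
  ...   | yes x+1<s = suc x , m<n (<-trans x+1<s s<m)
                    , trans (domSet-path (≤-trans p (n≤1+n x)) x+1<s) (cong (_≡ᵇ 2) (trans (cong m3 (+-∸-assoc 1 p)) (m3-next (x ∸ b) r)))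
                    , proj₂ (spine-consecutive-adj x+1<s)
  ...   | no x+1≮s = suc s , m<n 1+s<m , domSet-supp support-tail , child-adj x (suc s) (m<n 1+s<m) tail→x
    where
    tail→x : IsParent (suc s) x
    tail→x rewrite kind-Tail = cong (_∷ []) (cong pred (≤-antisym (≮⇒≥ x+1≮s) q))
  path-dominated {x} p q e | inj₁ r with x ∸ b in t≡
  ... | zero = spineParent x , m<n (spineParent<m q) , domSet-supp (supp-spineParent x≤b) , parent-adj x _ (spine-parent q)
    where
    x≤b : x ≤ b
    x≤b = ≤-reflexive (trans (sym (m+[n∸m]≡n p)) (trans (cong (b +_) t≡) (+-identityʳ b)))
    supp-spineParent : ∀ {y} → y ≤ b → IsSupport (spineParent y)
    supp-spineParent {zero} _ = support-head
    supp-spineParent {suc y} y<b = inj₁ y<b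
  ... | suc t = spineParent x , m<n (spineParent<m q) , parent-in , parent-adj x _ (spine-parent q)
    where
    x≡ : x ≡ suc (b + t)
    x≡ = trans (sym (m+[n∸m]≡n p)) (trans (cong (b +_) t≡) (+-suc b t))
    parent-in : domSet (spineParent x) ≡ true
    parent-in = subst (λ w → domSet (spineParent w) ≡ true) (sym x≡)
                  (trans (domSet-pathAt (<-trans (n<1+n t) (subst (_< k) t≡ (path-offset p q))))
                         (cong (_≡ᵇ 2) (m3-pred t r)))

  domSet-dominates : Dominates domSet
  domSet-dominates x x<n e with classify x
  ... | supportV sp = ⊥-elim (true≢false (trans (sym (domSet-supp sp)) e))
  ... | pathV p q = path-dominated p q e
  ... | leafV p = supportOf (x ∸ m) , m<n (support<m (leaf-support p x<n)) , domSet-supp (leaf-support p x<n) , parent-adj x _ (parents-Leaf p)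

  -- domSet meets every block at most once
  domSet-upper : cnt domSet n ≤ l + d3 k
  domSet-upper = labels-injective⇒≤ n domSet (blockOf d3) (l + d3 k) (bounded , injective)
    where
    in-path : ∀ {x} → b ≤ x → x < s → domSet x ≡ true → m3 (x ∸ b) ≡ 2
    in-path p q e = ≡ᵇ-true _ _ (trans (sym (domSet-path p q)) e)
    bounded : ∀ x → x < n → domSet x ≡ true → blockOf d3 x < l + d3 k
    bounded x x<n e with classify x
    ... | supportV sp = ≤-trans (pair-block<l d3 x<n (inj₁ sp)) (m≤m+n l _)
    ... | leafV p = ⊥-elim (true≢false (trans (sym e) (domSet-leaf p)))
    ... | pathV p q rewrite blockOf-path d3 p q = +-monoʳ-< l (lt-d3 _ k 3d+3≤k)
      where
      3d+3≤k : 3 * d3 (x ∸ b) + 3 ≤ k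
      3d+3≤k = subst (_≤ k) (trans (cong suc (sym (div-mod3 (x ∸ b)))) (trans (cong (λ w → suc (3 * d3 (x ∸ b) + w)) (in-path p q e)) (+3 (d3 (x ∸ b)))))
                       (path-offset p q)
        where
        +3 : ∀ u → suc (3 * u + 2) ≡ 3 * u + 3
        +3 = solve-∀
    injective : ∀ x y → x < n → y < n → domSet x ≡ true → domSet y ≡ true → blockOf d3 x ≡ blockOf d3 y → x ≡ y
    injective x y x<n y<n ex ey e with classify x | classify y
    ... | leafV p | _ = ⊥-elim (true≢false (trans (sym ex) (domSet-leaf p)))
    ... | _ | leafV p = ⊥-elim (true≢false (trans (sym ey) (domSet-leaf p)))
    ... | supportV sx | supportV sy = supp-block-inj d3 sx sy e
    ... | supportV sx | pathV p q = ⊥-elim (pair≢path d3 x<n (inj₁ sx) p q e)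
    ... | pathV p q | supportV sy = ⊥-elim (pair≢path d3 y<n (inj₁ sy) p q (sym e))
    ... | pathV p q | pathV p′ q′ = path-offset-inj p p′ (begin
      x ∸ b                                 ≡⟨ sym (div-mod3 (x ∸ b)) ⟩
      3 * d3 (x ∸ b) + m3 (x ∸ b)           ≡⟨ cong₂ (λ u v → 3 * u + v) (path-block-eq d3 p q p′ q′ e)
                                                     (trans (in-path p q ex) (sym (in-path p′ q′ ey))) ⟩
      3 * d3 (y ∸ b) + m3 (y ∸ b)           ≡⟨ div-mod3 (y ∸ b) ⟩
      y ∸ b ∎)
      where open ≡-Reasoning

  IndependentN : (ℕ → Bool) → Set
  IndependentN P = ∀ x y → x < n → y < n → P x ≡ true → P y ≡ true → adjN x y ≡ false

  -- an independent set meets every block at most once: two vertices in one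
  -- block are equal or adjacent
  independence-upper : ∀ P → IndependentN P → cnt P n ≤ l + d2 (suc k)
  independence-upper P ind = labels-injective⇒≤ n P (blockOf d2) (l + d2 (suc k)) (bounded , injective)
    where
    bounded : ∀ x → x < n → P x ≡ true → blockOf d2 x < l + d2 (suc k)
    bounded x x<n _ with classify x
    ... | supportV sp = ≤-trans (pair-block<l d2 x<n (inj₁ sp)) (m≤m+n l _)
    ... | leafV p = ≤-trans (pair-block<l d2 x<n (inj₂ p)) (m≤m+n l _)
    ... | pathV p q rewrite blockOf-path d2 p q = +-monoʳ-< l (lt-d2 _ (suc k) 2d+2≤k+1)
      where
      2d+2≤k+1 : 2 * d2 (x ∸ b) + 2 ≤ suc k
      2d+2≤k+1 = subst (_≤ suc k) (+-comm 2 _)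
        (s≤s (≤-trans (s≤s (≤-trans (m≤m+n (2 * d2 (x ∸ b)) (m2 (x ∸ b))) (≤-reflexive (div-mod2 (x ∸ b))))) (path-offset p q)))
    adjacent⇒⊥ : ∀ {x y} → x < n → y < n → P x ≡ true → P y ≡ true → adjN x y ≡ true → ⊥
    adjacent⇒⊥ {x} {y} x<n y<n px py adj = true≢false (trans (sym adj) (ind x y x<n y<n px py))
    injective : ∀ x y → x < n → y < n → P x ≡ true → P y ≡ true → blockOf d2 x ≡ blockOf d2 y → x ≡ y
    injective x y x<n y<n px py e with classify x | classify y
    ... | supportV sx | supportV sy = supp-block-inj d2 sx sy e
    ... | leafV p | leafV p′ = leaf-block-inj d2 p p′ e
    ... | supportV sx | leafV p′ = ⊥-elim (adjacent⇒⊥ y<n x<n py px (parent-adj y x (pair-parent d2 sx p′ e)))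
    ... | leafV p | supportV sy = ⊥-elim (adjacent⇒⊥ x<n y<n px py (parent-adj x y (pair-parent d2 sy p (sym e))))
    ... | supportV sx | pathV p q = ⊥-elim (pair≢path d2 x<n (inj₁ sx) p q e)
    ... | leafV p | pathV p′ q′ = ⊥-elim (pair≢path d2 x<n (inj₂ p) p′ q′ e)
    ... | pathV p q | supportV sy = ⊥-elim (pair≢path d2 y<n (inj₁ sy) p q (sym e))
    ... | pathV p q | leafV p′ = ⊥-elim (pair≢path d2 y<n (inj₂ p′) p q (sym e))
    ... | pathV p q | pathV p′ q′ with d2-close (x ∸ b) (y ∸ b) (path-block-eq d2 p q p′ q′ e)
    ...   | inj₁ same = path-offset-inj p p′ same
    ...   | inj₂ (inj₁ x=y+1) = ⊥-elim (adjacent⇒⊥ x<n y<n px py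
                                 (subst (λ w → adjN w y ≡ true) (sym x≡) (proj₁ (spine-consecutive-adj (subst (_< s) x≡ q)))))
      where
      x≡ : x ≡ suc y
      x≡ = trans (sym (m+[n∸m]≡n p)) (trans (cong (b +_) x=y+1) (trans (+-suc b _) (cong suc (m+[n∸m]≡n p′))))
    ...   | inj₂ (inj₂ y=x+1) = ⊥-elim (adjacent⇒⊥ y<n x<n py px
                                 (subst (λ w → adjN w x ≡ true) (sym y≡) (proj₁ (spine-consecutive-adj (subst (_< s) y≡ q′)))))
      where
      y≡ : y ≡ suc x
      y≡ = trans (sym (m+[n∸m]≡n p′)) (trans (cong (b +_) y=x+1) (trans (+-suc b _) (cong suc (m+[n∸m]≡n p))))

  -- The maximum independent set: all leaves, and every second path vertex
  -- (those b + t with t even).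

  indSet : ℕ → Bool
  indSet x = (m ≤ᵇ x) ∨ ((b ≤ᵇ x) ∧ ((x <ᵇ s) ∧ (m2 (x ∸ b) ≡ᵇ 0)))

  indSet-path : ∀ {x} → b ≤ x → x < s → indSet x ≡ (m2 (x ∸ b) ≡ᵇ 0)
  indSet-path {x} p q rewrite ≤ᵇ-false m x (<-trans q s<m) | ≤ᵇ-true b x p | <ᵇ-true x s q = refl

  indSet-leaf : ∀ {x} → m ≤ x → indSet x ≡ true
  indSet-leaf {x} p rewrite ≤ᵇ-true m x p = refl

  indSet-supp : ∀ {x} → IsSupport x → indSet x ≡ false
  indSet-supp {x} (inj₁ r) rewrite ≤ᵇ-false m x (support<m (inj₁ r)) | ≤ᵇ-false b x r = refl
  indSet-supp {x} (inj₂ (p , r)) rewrite ≤ᵇ-false m x r | <ᵇ-false x s p = ∧-zeroʳ (b ≤ᵇ x)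

  indSet-class : ∀ {x} → indSet x ≡ true → m ≤ x ⊎ (b ≤ x × x < s × m2 (x ∸ b) ≡ 0)
  indSet-class {x} e with classify x
  ... | supportV sp = ⊥-elim (true≢false (trans (sym e) (indSet-supp sp)))
  ... | leafV p = inj₁ p
  ... | pathV p q = inj₂ (p , q , ≡ᵇ-true _ _ (trans (sym (indSet-path p q)) e))

  -- leaves are adjacent only to supports, and consecutive path vertices have offsets of different parity
  indSet-independent : IndependentN indSet
  indSet-independent x y x<n y<n ex ey = ¬-not λ adj → clash adj (indSet-class ex) (indSet-class ey) (adj-cases x y adj)
    where
    leaf-parent-supp : ∀ {z w} → m ≤ z → z < n → IsParent z w → IsSupport w
    leaf-parent-supp p z<n h = subst IsSupport (∷-injectiveˡ (trans (sym (parents-Leaf p)) h)) (leaf-support p z<n)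
    odd-even : ∀ {u v} → b ≤ u → b ≤ v → m2 (u ∸ b) ≡ 0 → m2 (v ∸ b) ≡ 0 → v ≡ suc u → ⊥
    odd-even {u} {v} p p′ mu mv v≡ = 1≢0 (trans (sym (m2-next (u ∸ b) mu)) (trans (cong m2 (sym (trans (cong (_∸ b) v≡) (+-∸-assoc 1 p)))) mv))
      where
      1≢0 : 1 ≢ 0
      1≢0 ()
    clash : adjN x y ≡ true → m ≤ x ⊎ (b ≤ x × x < s × m2 (x ∸ b) ≡ 0) → m ≤ y ⊎ (b ≤ y × y < s × m2 (y ∸ b) ≡ 0)
          → IsParent x y ⊎ IsParent y x → ⊥
    clash _ (inj₁ lx) _ (inj₂ y→x) = <⇒≱ (parent<m y x y<n y→x) lx
    clash _ _ (inj₁ ly) (inj₁ x→y) = <⇒≱ (parent<m x y x<n x→y) ly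
    clash _ (inj₁ lx) (inj₂ (p , q , _)) (inj₁ x→y) = support-not-path (leaf-parent-supp lx x<n x→y) p q
    clash _ (inj₂ (p , q , _)) (inj₁ ly) (inj₂ y→x) = support-not-path (leaf-parent-supp ly y<n y→x) p q
    clash adj (inj₂ (p , q , mx)) (inj₂ (p′ , q′ , my)) _ with spine-adj q q′ adj
    ... | inj₁ x≡ = odd-even p′ p my mx x≡
    ... | inj₂ y≡ = odd-even p p′ mx my y≡

  -- indSet meets every block
  indSet-lower : l + d2 (suc k) ≤ cnt indSet n
  indSet-lower = labels-onto⇒≤ n indSet (blockOf d2) (l + d2 (suc k)) hit
    where
    hit : ∀ β → β < l + d2 (suc k) → ∃ λ x → x < n × indSet x ≡ true × blockOf d2 x ≡ β
    hit β β<B with β <? l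
    ... | yes β<l = m + β , +-monoʳ-< m β<l , indSet-leaf (m≤m+n m β) , trans (blockOf-leaf d2 (m≤m+n m β)) (m+n∸m≡n m β)
    ... | no β≮l = b + (2 * q + 0) , path<n 2q<k
                 , trans (indSet-path (m≤m+n b _) (+-monoʳ-< b 2q<k)) (cong (_≡ᵇ 0) (trans (cong m2 (m+n∸m≡n b _)) (proj₂ (d2-eq q 0 z<s))))
                 , trans (blockOf-pathAt d2 2q<k) (trans (cong (l +_) (proj₁ (d2-eq q 0 z<s))) β≡)
      where
      q = β ∸ l
      β≡ : l + q ≡ β
      β≡ = m+[n∸m]≡n (≮⇒≥ β≮l)
      2q<k : 2 * q + 0 < k
      2q<k = ≤-pred (subst (_≤ suc k) (+2 q) (d2-lt q (suc k) (+-cancelˡ-< l _ _ (subst (_< l + d2 (suc k)) (sym β≡) β<B))))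
        where
        +2 : ∀ q → 2 * q + 2 ≡ suc (suc (2 * q + 0))
        +2 = solve-∀

-- The shape of a non-increasing positive sequence d: with
-- B = n_{≥3}(d), M = n_{≥2}(d) and L = n_1(d), the entries are ≥ 3 on [0,B),
-- equal to 2 on [B,M) and equal to 1 on [M,n).
module DegreeProfile {n} (d : Fin n → ℕ) (ni : NonIncreasing d) (pos : ∀ i → 0 < d i) where

  dd : ℕ → ℕ
  dd = dN d

  dd-fin : ∀ x (p : x < n) → dd x ≡ d (fromℕ< p)
  dd-fin x p = trans (cong (dN d) (sym (toℕ-fromℕ< p))) (dN-toℕ d (fromℕ< p))

  dd-pos : ∀ x → x < n → 1 ≤ dd x
  dd-pos x p = subst (1 ≤_) (sym (dd-fin x p)) (pos (fromℕ< p))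

  dd-noninc : ∀ x y → x ≤ y → y < n → dd y ≤ dd x
  dd-noninc x y x≤y y<n =
    subst₂ _≤_ (sym (dd-fin y y<n)) (sym (dd-fin x x<n))
      (ni (fromℕ< x<n) (fromℕ< y<n) (subst₂ _≤_ (sym (toℕ-fromℕ< x<n)) (sym (toℕ-fromℕ< y<n)) x≤y))
    where
    x<n : x < n
    x<n = ≤-<-trans x≤y y<n

  atLeast : ℕ → ℕ → Bool
  atLeast i x = i ≤ᵇ dd x

  atLeast-closed : ∀ i → DownClosed n (atLeast i)
  atLeast-closed i x y x≤y y<n e = ≤ᵇ-true i _ (≤-trans (≤ᵇ-T i _ e) (dd-noninc x y x≤y y<n))

  M B L : ℕ
  M = cnt (atLeast 2) n
  B = cnt (atLeast 3) n
  L = cnt (λ x → dd x ≡ᵇ 1) n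

  M≤n : M ≤ n
  M≤n = cnt-≤ n (atLeast 2)

  deg-big : ∀ x → x < B → 3 ≤ dd x
  deg-big x x<B = ≤ᵇ-T 3 _ (inPrefix n (atLeast 3) (atLeast-closed 3) x (<-≤-trans x<B (cnt-≤ n _)) x<B)

  deg-≤2 : ∀ x → B ≤ x → x < n → dd x ≤ 2
  deg-≤2 x B≤x x<n = ≤-pred (≤ᵇ-F 3 _ (outPrefix n (atLeast 3) (atLeast-closed 3) x x<n B≤x))

  deg-≥2 : ∀ x → x < M → 2 ≤ dd x
  deg-≥2 x x<M = ≤ᵇ-T 2 _ (inPrefix n (atLeast 2) (atLeast-closed 2) x (<-≤-trans x<M M≤n) x<M)

  deg-one : ∀ x → M ≤ x → x < n → dd x ≡ 1
  deg-one x M≤x x<n =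
    ≤-antisym (≤-pred (≤ᵇ-F 2 _ (outPrefix n (atLeast 2) (atLeast-closed 2) x x<n M≤x))) (dd-pos x x<n)

  B≤M : B ≤ M
  B≤M = ≮⇒≥ λ M<B → <-irrefl refl
          (prefix-true n (atLeast 2) (atLeast-closed 2) M (<-≤-trans M<B (cnt-≤ n _))
             (≤ᵇ-true 2 _ (≤-trans (s≤s (s≤s z≤n)) (deg-big M M<B))))

  deg-two : ∀ x → B ≤ x → x < M → dd x ≡ 2
  deg-two x B≤x x<M = ≤-antisym (deg-≤2 x B≤x (<-≤-trans x<M M≤n)) (deg-≥2 x x<M)

  n≡M+L : n ≡ M + L
  n≡M+L = begin
    n                                                 ≡⟨ sym (m+[n∸m]≡n M≤n) ⟩
    M + (n ∸ M)                                       ≡⟨ cong (M +_) (sym (cnt-true (n ∸ M) _ one-beyond)) ⟩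
    M + cnt (λ y → dd (M + y) ≡ᵇ 1) (n ∸ M)           ≡⟨ cong (λ z → M + (z + cnt (λ y → dd (M + y) ≡ᵇ 1) (n ∸ M))) (sym (cnt-false M _ not-one-before)) ⟩
    M + (cnt (λ x → dd x ≡ᵇ 1) M + cnt (λ y → dd (M + y) ≡ᵇ 1) (n ∸ M))
                                                      ≡⟨ cong (M +_) (sym (cnt-split M (n ∸ M) _)) ⟩
    M + cnt (λ x → dd x ≡ᵇ 1) (M + (n ∸ M))           ≡⟨ cong (λ z → M + cnt (λ x → dd x ≡ᵇ 1) z) (m+[n∸m]≡n M≤n) ⟩
    M + L ∎
    where
    open ≡-Reasoning
    not-one-before : ∀ x → x < M → (dd x ≡ᵇ 1) ≡ false
    not-one-before x x<M = ≡ᵇ-false _ 1 (λ e → 1+n≰n (subst (2 ≤_) e (deg-≥2 x x<M)))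
    one-beyond : ∀ y → y < n ∸ M → (dd (M + y) ≡ᵇ 1) ≡ true
    one-beyond y p = subst (λ v → (v ≡ᵇ 1) ≡ true) (sym (deg-one (M + y) (m≤m+n M y) M+y<n)) refl
      where
      M+y<n : M + y < n
      M+y<n = subst (M + y <_) (m+[n∸m]≡n M≤n) (+-monoʳ-< M p)

  degree-sum : seqSum d ≡ (surplus dd B + 3 * B) + ((M ∸ B) * 2 + L * 1)
  degree-sum = begin
    seqSum d                                  ≡⟨ seqSum-sumN d ⟩
    sumN dd n                                 ≡⟨ cong (sumN dd) layout ⟩
    sumN dd (B + ((M ∸ B) + L))               ≡⟨ sumN-split B _ dd ⟩
    sumN dd B + sumN (λ x → dd (B + x)) ((M ∸ B) + L)
                                              ≡⟨ cong₂ _+_ (sum-via-surplus dd B deg-big) (sumN-split (M ∸ B) L _) ⟩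
    (surplus dd B + 3 * B) + (sumN (λ x → dd (B + x)) (M ∸ B) + sumN (λ x → dd (B + ((M ∸ B) + x))) L)
                                              ≡⟨ cong ((surplus dd B + 3 * B) +_)
                                                   (cong₂ _+_ (sumN-const (M ∸ B) _ 2 two) (sumN-const L _ 1 one)) ⟩
    (surplus dd B + 3 * B) + ((M ∸ B) * 2 + L * 1) ∎
    where
    open ≡-Reasoning
    B+[M∸B] : B + (M ∸ B) ≡ M
    B+[M∸B] = m+[n∸m]≡n B≤M
    layout : n ≡ B + ((M ∸ B) + L)
    layout = trans n≡M+L (trans (cong (_+ L) (sym B+[M∸B])) (+-assoc B (M ∸ B) L))
    two : ∀ x → x < M ∸ B → dd (B + x) ≡ 2
    two x p = deg-two (B + x) (m≤m+n B x) (subst (B + x <_) B+[M∸B] (+-monoʳ-< B p))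
    one : ∀ x → x < L → dd (B + ((M ∸ B) + x)) ≡ 1
    one x p = subst (λ y → dd y ≡ 1) (sym shift)
                (deg-one (M + x) (m≤m+n M x) (subst (M + x <_) (sym n≡M+L) (+-monoʳ-< M p)))
      where
      shift : B + ((M ∸ B) + x) ≡ M + x
      shift = trans (sym (+-assoc B (M ∸ B) x)) (cong (_+ x) B+[M∸B])

record Realisation (n c : ℕ) (d : Fin n → ℕ) : Set where
  field
    big path extra : ℕ
  open Construction big path extra (dN d) using (l; Profile) renaming (n to size)
  field
    size≡n : size ≡ n
    l≡n₁ : l ≡ nEq 1 d
    extra≡c : suc extra ≡ c
    profile : Profile

-- Every sequence satisfying the hypotheses of the theorem is realised with
-- b = n_{≥3}(d), k = n_{≥2}(d) − n_1(d) and c − 1 further components: the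
-- degree-sum identity  Σ d = 2n − 2c  says exactly  n_1 = surplus + b + 2c,
-- i.e. that the construction has the right number of leaves.
realise : ∀ n c (d : Fin n → ℕ) → NonIncreasing d → (∀ i → 0 < d i) → 0 < c
        → seqSum d + 2 * c ≡ 2 * n → nEq 1 d ≤ nGe 2 d → Realisation n c d
realise n (suc cm) d ni pos _ sum≡ n₁≤n₂ = record
  { big = B ; path = M ∸ L ; extra = cm
  ; size≡n = trans (cong₂ _+_ m≡M l≡L) (sym n≡M+L)
  ; l≡n₁ = trans l≡L L≡n₁
  ; extra≡c = refl
  ; profile = record
    { deg-big = deg-big
    ; deg-two = λ x p q → deg-two x p (subst (x <_) m≡M q)
    ; deg-one = λ x p q → deg-one x (subst (_≤ x) m≡M p) (subst (x <_) (trans (cong₂ _+_ m≡M l≡L) (sym n≡M+L)) q)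
    }
  }
  where
  open DegreeProfile d ni pos
  open Construction B (M ∸ L) cm dd using (m; l)
  Q = surplus dd B
  L≡n₁ : L ≡ nEq 1 d
  L≡n₁ = sym (count-cnt∘ d (λ v → v ≡ᵇ 1))
  L≤M : L ≤ M
  L≤M = subst₂ _≤_ (sym L≡n₁) (count-cnt∘ d (λ v → 2 ≤ᵇ v)) n₁≤n₂
  leaves : Q + B + 2 * suc cm ≡ L
  leaves = +-cancelˡ-≡ (2 * B + 2 * (M ∸ B) + L) _ _ (begin
    2 * B + 2 * (M ∸ B) + L + (Q + B + 2 * suc cm)   ≡⟨ regroup₁ Q B (M ∸ B) L cm ⟩
    (Q + 3 * B) + ((M ∸ B) * 2 + L * 1) + 2 * suc cm  ≡⟨ cong (_+ 2 * suc cm) (sym degree-sum) ⟩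
    seqSum d + 2 * suc cm                            ≡⟨ sum≡ ⟩
    2 * n                                            ≡⟨ cong (2 *_) (trans n≡M+L (cong (_+ L) (sym (m+[n∸m]≡n B≤M)))) ⟩
    2 * (B + (M ∸ B) + L)                            ≡⟨ regroup₂ B (M ∸ B) L ⟩
    2 * B + 2 * (M ∸ B) + L + L ∎)
    where
    open ≡-Reasoning
    regroup₁ : ∀ q b u l c → 2 * b + 2 * u + l + (q + b + 2 * suc c) ≡ (q + 3 * b) + (u * 2 + l * 1) + 2 * suc c
    regroup₁ = solve-∀
    regroup₂ : ∀ b u l → 2 * (b + u + l) ≡ 2 * b + 2 * u + l + l
    regroup₂ = solve-∀
  l≡L : l ≡ L
  l≡L = trans (regroup B Q cm) leaves
    where
    regroup : ∀ b q c → b + suc (suc (q + c + c)) ≡ q + b + 2 * suc c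
    regroup = solve-∀
  m≡M : m ≡ M
  m≡M = trans (regroup B (M ∸ L) Q cm) (trans (cong (_+ (M ∸ L)) l≡L) (m+[n∸m]≡n L≤M))
    where
    regroup : ∀ b k q c → suc (suc (b + k + q + c + c)) ≡ b + suc (suc (q + c + c)) + k
    regroup = solve-∀

module Realised {n c : ℕ} {d : Fin n → ℕ} (R : Realisation n c d) where

  open Realisation R
  open Construction big path extra (dN d) renaming (n to N)
  open Extremal big path extra (dN d)
  open Profile profile

  bound : (v : Fin n) → toℕ v < N
  bound v = subst (toℕ v <_) (sym size≡n) (toℕ<n v)

  vertex : ∀ x → x < N → Fin n
  vertex x p = fromℕ< (subst (x <_) size≡n p)

  toℕ-vertex : ∀ x (p : x < N) → toℕ (vertex x p) ≡ x
  toℕ-vertex x p = toℕ-fromℕ< (subst (x <_) size≡n p)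

  count-N : ∀ P → count {n} (λ v → P (toℕ v)) ≡ cnt P N
  count-N P = trans (count-cnt n P) (cong (cnt P) (sym size≡n))

  card-N : ∀ (D : Subset n) → ∣ D ∣ ≡ cnt (lk D) N
  card-N D = trans (card-cnt D) (cong (cnt (lk D)) (sym size≡n))

  F : Graph n
  F = record
    { adj = λ u v → adjN (toℕ u) (toℕ v)
    ; sym = λ u v → adjN-sym _ _ (bound u) (bound v)
    ; irrefl = λ v → adjN-irrefl _ (bound v) }

  count-nbrs : ∀ v (Q : ℕ → Bool) → count {n} (λ u → adjN (toℕ v) (toℕ u) ∧ Q (toℕ u)) ≡ cntL Q (nbrs (toℕ v))
  count-nbrs v Q = trans (count-N (λ y → adjN (toℕ v) y ∧ Q y))
                         (cnt-elem N Q (nbrs (toℕ v)) (NbrData.nbD nd) (NbrData.nbB nd))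
    where
    nd = nbrData profile (toℕ v) (bound v)

  deg-F : ∀ v → deg F v ≡ dN d (toℕ v)
  deg-F v = begin
    deg F v                                                ≡⟨ count-ext {n} (λ u → adjN (toℕ v) (toℕ u)) (λ u → adjN (toℕ v) (toℕ u) ∧ true)
                                                                (λ u → sym (∧-identityʳ (adjN (toℕ v) (toℕ u)))) ⟩
    count {n} (λ u → adjN (toℕ v) (toℕ u) ∧ true)         ≡⟨ count-nbrs v (λ _ → true) ⟩
    cntL (λ _ → true) (nbrs (toℕ v))                       ≡⟨ NbrData.nbDeg (nbrData profile (toℕ v) (bound v)) ⟩
    dN d (toℕ v) ∎
    where open ≡-Reasoning

  has-degrees : HasDegrees F d
  has-degrees v = trans (deg-F v) (dN-toℕ d v)

  degree-one : ∀ y → y < N → (dN d y ≡ᵇ 1) ≡ (m ≤ᵇ y)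
  degree-one y y<N with y <? m
  ... | no y≮m rewrite deg-one y (≮⇒≥ y≮m) y<N | ≤ᵇ-true m y (≮⇒≥ y≮m) = refl
  ... | yes y<m rewrite ≤ᵇ-false m y y<m with y <? big
  ...   | yes y<b = ≡ᵇ-false _ _ (λ e → <⇒≱ (s≤s (s≤s z≤n)) (subst (3 ≤_) e (deg-big y y<b)))
  ...   | no y≮b rewrite deg-two y (≮⇒≥ y≮b) y<m = refl

  inner-≥2 : ∀ x → x < m → (2 ≤ᵇ dN d x) ≡ true
  inner-≥2 x p with x <? big
  ... | yes q = ≤ᵇ-true 2 _ (≤-trans (s≤s (s≤s z≤n)) (deg-big x q))
  ... | no q rewrite deg-two x (≮⇒≥ q) p = refl

  leafNbrs-F : ∀ v → leafNbrs F v ≡ b2n (isSupportN (toℕ v))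
  leafNbrs-F v = begin
    leafNbrs F v                                           ≡⟨ count-ext {n} (λ u → adjN (toℕ v) (toℕ u) ∧ (deg F u ≡ᵇ 1))
                                                                (λ u → adjN (toℕ v) (toℕ u) ∧ (m ≤ᵇ toℕ u))
                                                                (λ u → cong (λ w → adjN (toℕ v) (toℕ u) ∧ w)
                                                                  (trans (cong (_≡ᵇ 1) (deg-F u)) (degree-one (toℕ u) (bound u)))) ⟩
    count {n} (λ u → adjN (toℕ v) (toℕ u) ∧ (m ≤ᵇ toℕ u))  ≡⟨ count-nbrs v (m ≤ᵇ_) ⟩
    cntL (m ≤ᵇ_) (nbrs (toℕ v))                            ≡⟨ NbrData.nbLf (nbrData profile (toℕ v) (bound v)) ⟩
    b2n (isSupportN (toℕ v)) ∎
    where open ≡-Reasoning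

  isSupport-F : ∀ v → isSupport F v ≡ isSupportN (toℕ v)
  isSupport-F v rewrite deg-F v | leafNbrs-F v with toℕ v <? m
  ... | yes p rewrite inner-≥2 (toℕ v) p with isSupportN (toℕ v)
  ...   | true = refl
  ...   | false = refl
  isSupport-F v | no p rewrite deg-one (toℕ v) (≮⇒≥ p) (bound v) | isSupportN-leaf (≮⇒≥ p) = refl

  support-one-leaf : ∀ v → isSupport F v ≡ true → leafNbrs F v ≡ 1
  support-one-leaf v e = trans (leafNbrs-F v) (cong b2n (trans (sym (isSupport-F v)) e))

  support-count : count (isSupport F) ≡ nEq 1 d
  support-count = trans (count-ext _ _ isSupport-F) (trans (count-N isSupportN) (trans support-countN l≡n₁))

  isPathN : ℕ → Bool
  isPathN x = (big ≤ᵇ x) ∧ (x <ᵇ s)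

  inner-nonsupport : ∀ v → isInnerNonSupport F v ≡ isPathN (toℕ v)
  inner-nonsupport v rewrite isSupport-F v | deg-F v with classify (toℕ v)
  ... | supportV (inj₁ p) rewrite isSupportN-big p | ≤ᵇ-false big (toℕ v) p = ∧-zeroʳ _
  ... | supportV (inj₂ (p , q)) rewrite isSupportN-inner p q | <ᵇ-false (toℕ v) s p = trans (∧-zeroʳ _) (sym (∧-zeroʳ _))
  ... | pathV p q rewrite isSupportN-path p q | deg-two (toℕ v) p (<-trans q s<m) | ≤ᵇ-true big (toℕ v) p | <ᵇ-true (toℕ v) s q = refl
  ... | leafV p rewrite deg-one (toℕ v) p (bound v) | <ᵇ-false (toℕ v) s (≤-trans (<⇒≤ s<m) p) = sym (∧-zeroʳ _)

  isPathN-T : ∀ {x} → isPathN x ≡ true → big ≤ x × x < s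
  isPathN-T e with ∧-T _ _ e
  ... | p , q = ≤ᵇ-T _ _ p , <ᵇ-T _ _ q

  inner-deg : ∀ v → isInnerNonSupport F v ≡ true → deg F v ≡ 2
  inner-deg v e with isPathN-T (trans (sym (inner-nonsupport v)) e)
  ... | p , q = trans (deg-F v) (deg-two (toℕ v) p (<-trans q s<m))

  pathVertex : Fin path → Fin n
  pathVertex i = vertex (big + toℕ i) (path<n (toℕ<n i))

  toℕ-pathVertex : ∀ i → toℕ (pathVertex i) ≡ big + toℕ i
  toℕ-pathVertex i = toℕ-vertex _ (path<n (toℕ<n i))

  pathVertex<s : ∀ i → toℕ (pathVertex i) < s
  pathVertex<s i = subst (_< s) (sym (toℕ-pathVertex i)) (+-monoʳ-< big (toℕ<n i))

  pathVertex-adj : ∀ i j → adj F (pathVertex i) (pathVertex j) ≡ true → toℕ i ≡ suc (toℕ j) ⊎ toℕ j ≡ suc (toℕ i)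
  pathVertex-adj i j e with spine-adj (pathVertex<s i) (pathVertex<s j) e
  ... | inj₁ r = inj₁ (+-cancelˡ-≡ big _ _ (trans (sym (toℕ-pathVertex i)) (trans r (trans (cong suc (toℕ-pathVertex j)) (sym (+-suc big (toℕ j)))))))
  ... | inj₂ r = inj₂ (+-cancelˡ-≡ big _ _ (trans (sym (toℕ-pathVertex j)) (trans r (trans (cong suc (toℕ-pathVertex i)) (sym (+-suc big (toℕ i)))))))

  consecutive-adj : ∀ i j → toℕ i ≡ suc (toℕ j) → adj F (pathVertex i) (pathVertex j) ≡ true
  consecutive-adj i j r = subst₂ (λ u w → adjN u w ≡ true) (sym i≡) (sym (toℕ-pathVertex j)) (proj₁ (spine-consecutive-adj 1+j<s))
    where
    i≡ : toℕ (pathVertex i) ≡ suc (big + toℕ j)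
    i≡ = trans (toℕ-pathVertex i) (trans (cong (big +_) r) (+-suc big (toℕ j)))
    1+j<s : suc (big + toℕ j) < s
    1+j<s = subst (_< s) i≡ (pathVertex<s i)

  induced-path : InducesPath F (isInnerNonSupport F) path
  induced-path = pathVertex , injective , (λ v → mk⇔ (onPath v) (offPath v)) , (λ i j → mk⇔ (pathVertex-adj i j) (adjacent i j))
    where
    injective : ∀ {i j} → pathVertex i ≡ pathVertex j → i ≡ j
    injective {i} {j} e = toℕ-injective (+-cancelˡ-≡ big _ _ (trans (sym (toℕ-pathVertex i)) (trans (cong toℕ e) (toℕ-pathVertex j))))
    onPath : ∀ v → isInnerNonSupport F v ≡ true → ∃ λ i → pathVertex i ≡ v
    onPath v e with isPathN-T (trans (sym (inner-nonsupport v)) e)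
    ... | p , q = fromℕ< (path-offset p q)
                , toℕ-injective (trans (toℕ-pathVertex _) (trans (cong (big +_) (toℕ-fromℕ< (path-offset p q))) (m+[n∸m]≡n p)))
    offPath : ∀ v → (∃ λ i → pathVertex i ≡ v) → isInnerNonSupport F v ≡ true
    offPath v (i , refl) = trans (inner-nonsupport v) (subst (λ w → isPathN w ≡ true) (sym (toℕ-pathVertex i))
                             (trans (cong (_∧ ((big + toℕ i) <ᵇ s)) (≤ᵇ-true big _ (m≤m+n big (toℕ i))))
                                    (<ᵇ-true _ s (+-monoʳ-< big (toℕ<n i)))))
    adjacent : ∀ i j → (toℕ i ≡ suc (toℕ j) ⊎ toℕ j ≡ suc (toℕ i)) → adj F (pathVertex i) (pathVertex j) ≡ true
    adjacent i j (inj₁ r) = consecutive-adj i j r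
    adjacent i j (inj₂ r) = trans (Graph.sym F _ _) (consecutive-adj j i r)

  path≡n-2n₁ : n ∸ 2 * nEq 1 d ≡ path
  path≡n-2n₁ = trans (cong₂ _∸_ (trans (sym size≡n) n≡k+l+l) (cong (2 *_) (sym l≡n₁))) (cancel path l)
    where
    cancel : ∀ k l → k + l + l ∸ 2 * l ≡ k
    cancel k l rewrite +-identityʳ l | +-assoc k l l = m+n∸n≡m k (l + l)

  comp<c′ : (v : Fin n) → comp (toℕ v) < c
  comp<c′ v = subst (comp (toℕ v) <_) extra≡c (comp<c (bound v))

  compF : Fin n → Fin c
  compF v = fromℕ< (comp<c′ v)

  reach⇒comp : ∀ {u v} → Reach F u v → comp (toℕ u) ≡ comp (toℕ v)
  reach⇒comp here = refl
  reach⇒comp (step {u} {w} e r) = trans (along e) (reach⇒comp r)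
    where
    along : adj F u w ≡ true → comp (toℕ u) ≡ comp (toℕ w)
    along e with adj-cases (toℕ u) (toℕ w) e
    ... | inj₁ r = comp-parent _ _ (bound u) r
    ... | inj₂ r = sym (comp-parent _ _ (bound w) r)

  rootVertex : (u : Fin n) → Fin n
  rootVertex u = vertex (root (comp (toℕ u))) (root<N u)
    where
    root<N : (u : Fin n) → root (comp (toℕ u)) < N
    root<N u = m<n (root<m (comp (toℕ u)) (comp<c (bound u)))

  toℕ-rootVertex : ∀ u → toℕ (rootVertex u) ≡ root (comp (toℕ u))
  toℕ-rootVertex u = toℕ-vertex _ (m<n (root<m (comp (toℕ u)) (comp<c (bound u))))

  reach-root : ∀ f (u : Fin n) → rank (toℕ u) < f → Reach F u (rootVertex u)
  reach-root (suc f) u rank<f with parents-shape (kind (toℕ u)) (toℕ u)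
  ... | inj₁ parentless = subst (Reach F u) (toℕ-injective (trans (parentless-root _ (bound u) parentless)
                                                               (sym (toℕ-rootVertex u)))) here
  ... | inj₂ (y , u→y) = step (subst (λ t → adjN (toℕ u) t ≡ true) (sym (toℕ-vertex y y<N)) (parent-adj _ _ u→y))
                              (subst (Reach F w) same-root (reach-root f w rank-w<f))
    where
    y<N : y < N
    y<N = m<n (parent<m _ _ (bound u) u→y)
    w = vertex y y<N
    rank-w<f : rank (toℕ w) < f
    rank-w<f = ≤-pred (≤-trans (s≤s (subst (λ t → rank t < rank (toℕ u)) (sym (toℕ-vertex y y<N)) (rank-lt _ _ (bound u) u→y))) rank<f)
    same-root : rootVertex w ≡ rootVertex u
    same-root = toℕ-injective (trans (toℕ-rootVertex w) (trans (cong root (trans (cong comp (toℕ-vertex y y<N)) (sym (comp-parent _ _ (bound u) u→y))))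
                                                                  (sym (toℕ-rootVertex u))))

  comp⇒reach : ∀ u v → comp (toℕ u) ≡ comp (toℕ v) → Reach F u v
  comp⇒reach u v e = reach-++ (reach-root _ u ≤-refl)
                       (subst (λ t → Reach F t v) same-root (reach-rev (reach-root _ v ≤-refl)))
    where
    same-root : rootVertex v ≡ rootVertex u
    same-root = toℕ-injective (trans (toℕ-rootVertex v) (trans (cong root (sym e)) (sym (toℕ-rootVertex u))))

  has-components : HasComponents F c
  has-components = compF , onto , (λ u v → mk⇔ (λ e → comp⇒reach u v (fromF e)) (λ r → toF (reach⇒comp r)))
    where
    fromF : ∀ {u v} → compF u ≡ compF v → comp (toℕ u) ≡ comp (toℕ v)
    fromF {u} {v} e = trans (sym (toℕ-fromℕ< (comp<c′ u))) (trans (cong toℕ e) (toℕ-fromℕ< (comp<c′ v)))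
    toF : ∀ {u v} → comp (toℕ u) ≡ comp (toℕ v) → compF u ≡ compF v
    toF {u} {v} e = toℕ-injective (trans (toℕ-fromℕ< (comp<c′ u)) (trans e (sym (toℕ-fromℕ< (comp<c′ v)))))
    onto : ∀ (r : Fin c) → ∃ λ x → ∀ {z} → z ≡ x → compF z ≡ r
    onto r = w , λ { refl → toℕ-injective (trans (toℕ-fromℕ< (comp<c′ w)) (trans (cong comp (toℕ-vertex (root i) root<N)) (root-comp i i<c))) }
      where
      i = toℕ r
      i<c : i < suc extra
      i<c = subst (i <_) (sym extra≡c) (toℕ<n r)
      root<N : root i < N
      root<N = m<n (root<m i i<c)
      w = vertex (root i) root<N

  -- F has no cycle: at a vertex of maximal rank on a cycle, both cycle
  -- neighbours would be its parent.
  forest : Forest F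
  forest (K , p , injective , consecutive , closing) with argmax (λ j → rank (toℕ (p j)))
  ... | i , maximal with cycle-two-nbrs F K p consecutive closing i
  ...   | j₁ , j₂ , a₁ , a₂ , j₁≢j₂ =
    j₁≢j₂ (cong toℕ (injective (toℕ-injective (∷-injectiveˡ (trans (sym (parent-of j₁ a₁)) (parent-of j₂ a₂))))))
    where
    parent-of : ∀ j → adj F (p i) (p j) ≡ true → IsParent (toℕ (p i)) (toℕ (p j))
    parent-of j e with adj-cases (toℕ (p i)) (toℕ (p j)) e
    ... | inj₁ r = r
    ... | inj₂ r = ⊥-elim (<⇒≱ (rank-lt _ _ (bound (p j)) r) (maximal j))

  dominates : ∀ D → Dominating F D → Dominates (lk D)
  dominates D dom x x<N e with dom (vertex x x<N) (λ x∈D → true≢false (trans (sym (subst (λ t → lk D t ≡ true) (toℕ-vertex x x<N) (mem→lk D _ x∈D))) e))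
  ... | u , u∈D , adj = toℕ u , bound u , mem→lk D u u∈D , subst (λ t → adjN t (toℕ u) ≡ true) (toℕ-vertex x x<N) adj

  domSetF : Subset n
  domSetF = tabulate (λ v → domSet (toℕ v))

  domSetF-dominating : Dominating F domSetF
  domSetF-dominating v v∉D with domSet (toℕ v) in e
  ... | true = ⊥-elim (v∉D (mem-tab _ v e))
  ... | false with domSet-dominates (toℕ v) (bound v) e
  ...   | u , u<N , in-u , adj = vertex u u<N , mem-tab _ _ (subst (λ t → domSet t ≡ true) (sym (toℕ-vertex u u<N)) in-u)
                                 , subst (λ t → adjN (toℕ v) t ≡ true) (sym (toℕ-vertex u u<N)) adj

  domination-number : DominationNumber F (l + d3 path)
  domination-number = (domSetF , domSetF-dominating , ≤-antisym (subst (_≤ l + d3 path) (sym (count-N domSet)) domSet-upper) (lower domSetF domSetF-dominating))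
                    , lower
    where
    lower : ∀ D → Dominating F D → l + d3 path ≤ ∣ D ∣
    lower D dom = subst (l + d3 path ≤_) (sym (card-N D)) (domination-lower (lk D) (dominates D dom))

  independent : ∀ D → Independent F D → IndependentN (lk D)
  independent D ind x y x<N y<N px py =
    subst₂ (λ u w → adjN u w ≡ false) (toℕ-vertex x x<N) (toℕ-vertex y y<N)
      (ind (vertex x x<N) (vertex y y<N) (member x x<N px) (member y y<N py))
    where
    member : ∀ z (z<N : z < N) → lk D z ≡ true → vertex z z<N ∈ D
    member z z<N e = lk→mem D _ (subst (λ t → lk D t ≡ true) (sym (toℕ-vertex z z<N)) e)

  indSetF : Subset n
  indSetF = tabulate (λ v → indSet (toℕ v))

  indSetF-independent : Independent F indSetF
  indSetF-independent u v u∈I v∈I = indSet-independent _ _ (bound u) (bound v) (tab-mem _ u u∈I) (tab-mem _ v v∈I)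

  independence-number : IndependenceNumber F (l + d2 (suc path))
  independence-number = (indSetF , indSetF-independent , ≤-antisym (upper indSetF indSetF-independent) (subst (l + d2 (suc path) ≤_) (sym (count-N indSet)) indSet-lower))
                      , upper
    where
    upper : ∀ D → Independent F D → ∣ D ∣ ≤ l + d2 (suc path)
    upper D ind = subst (_≤ l + d2 (suc path)) (sym (card-N D)) (independence-upper (lk D) (independent D ind))

  -- the values in the statement: n = k + 2l, so ⌈(n + l − 2)/3⌉ = l + ⌊k/3⌋ and ⌈n/2⌉ = l + ⌈k/2⌉
  n≡k+2l : n ≡ path + l + l
  n≡k+2l = trans (sym size≡n) n≡k+l+l

  γ-value : ceil3 (n + nEq 1 d ∸ 2) ≡ l + d3 path
  γ-value = begin
    (n + nEq 1 d ∸ 2 + 2) / 3           ≡⟨ cong (λ w → (w ∸ 2 + 2) / 3) (cong₂ _+_ n≡k+2l (sym l≡n₁)) ⟩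
    (path + l + l + l ∸ 2 + 2) / 3      ≡⟨ cong (_/ 3) (m∸n+n≡m (≤-trans 2≤l (m≤n+m l (path + l + l)))) ⟩
    (path + l + l + l) / 3              ≡⟨ sym (d3-div _) ⟩
    d3 (path + l + l + l)               ≡⟨ cong d3 (regroup path l) ⟩
    d3 (3 * l + path)                   ≡⟨ d3-add l path ⟩
    l + d3 path ∎
    where
    open ≡-Reasoning
    2≤l : 2 ≤ l
    2≤l = ≤-trans (s≤s (s≤s z≤n)) (m≤n+m a big)
    regroup : ∀ k l → k + l + l + l ≡ 3 * l + k
    regroup = solve-∀

  α-value : ceil2 n ≡ l + d2 (suc path)
  α-value = begin
    (n + 1) / 2                         ≡⟨ cong (λ w → (w + 1) / 2) n≡k+2l ⟩
    (path + l + l + 1) / 2              ≡⟨ sym (d2-div _) ⟩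
    d2 (path + l + l + 1)               ≡⟨ cong d2 (regroup path l) ⟩
    d2 (2 * l + suc path)               ≡⟨ d2-add l (suc path) ⟩
    l + d2 (suc path) ∎
    where
    open ≡-Reasoning
    regroup : ∀ k l → k + l + l + 1 ≡ 2 * l + suc k
    regroup = solve-∀

lemma2 : (n c : ℕ) (d : Fin n → ℕ)
    → NonIncreasing d
    → (∀ i → 0 < d i)
    → 0 < c
    → seqSum d + 2 * c ≡ 2 * n
    → nEq 1 d ≤ nGe 2 d
    → Σ (Graph n) λ F →
        Forest F × HasComponents F c × HasDegrees F d
        × (count (isSupport F) ≡ nEq 1 d
           × (∀ v → isSupport F v ≡ true → leafNbrs F v ≡ 1))
        × ((∀ v → isInnerNonSupport F v ≡ true → deg F v ≡ 2)
           × InducesPath F (isInnerNonSupport F) (n ∸ 2 * nEq 1 d))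
        × (DominationNumber F (ceil3 (n + nEq 1 d ∸ 2))
           × IndependenceNumber F (ceil2 n))
lemma2 n c d ni pos c>0 sum≡ n₁≤n₂ =
  F , forest , has-components , has-degrees
    , (support-count , support-one-leaf)
    , (inner-deg , subst (InducesPath F (isInnerNonSupport F)) (sym path≡n-2n₁) induced-path)
    , ( subst (DominationNumber F) (sym γ-value) domination-number
      , subst (IndependenceNumber F) (sym α-value) independence-number)
  where
  open Realised (realise n c d ni pos c>0 sum≡ n₁≤n₂)
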